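{- For all $i\ge1$ and central variables $x,y$, $$(1 - xy\, \widetilde{u}_i \widetilde{d}_i)^{ -1} (1 + x\widetilde{u}_i)(1+y\, \widetilde{d}_{i+1}) = (1 - xy\, \widetilde{d}_{i+1} \widetilde{u}_{i+1})^{ -1} (1 + y\widetilde{d}_{i+1})(1+x\, \widetilde{u}_{i}).$$
   Context: $\beta$ is a scalar and $\mathbb{Z}[\beta]P$ the free $\mathbb{Z}[\beta]$-module with basis all partitions (Young diagrams, columns indexed from the left). $u_i\cdot\lambda$ adds a box in column $i$ and $d_i\cdot\lambda$ removes a box from column $i$ (each $0$ if the result is not a partition). $\widetilde u_i=u_i(1-\beta d_i)$, $\widetilde d_i=(1-\beta d_i)^{ -1}d_i=\sum_{k\ge1}\beta^{k-1}d_i^k$. Inverses $(1-z)^{ -1}$ are the geometric series $\sum_{k\ge0}z^k$. -}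

module Defs where

open import Data.Nat using (ℕ; zero; suc; _+_; _∸_; _≤_; _≤?_)
import Data.Nat as ℕ
open import Data.Integer using (ℤ; +_; -_)
import Data.Integer as ℤ
open import Data.List using (List; []; _∷_; _++_; map; concatMap; upTo; foldr)
open import Data.Nat.ListAction using (sum)
open import Data.List.Properties using (≡-dec)
open import Data.Maybe using (Maybe; just; nothing; maybe)
import Data.Maybe as Maybe
open import Data.Product using (_×_; _,_)
open import Relation.Nullary using (yes; no)
open import Relation.Binary.PropositionalEquality using (_≡_)

-- Partitions: list of row lengths (Young diagram, English convention),
-- weakly decreasing and positive.  Column i (1-indexed, from the left)
-- has length #{rows r with r ≥ i}.

data IsPartition : List ℕ → Set where
  nil  : IsPartition []
  one  : ∀ {r} → 1 ≤ r → IsPartition (r ∷ [])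
  cons : ∀ {r s rs} → s ≤ r → IsPartition (s ∷ rs) → IsPartition (r ∷ s ∷ rs)

-- add a box in column i (i ≥ 1): the first row of length < i must have
-- length exactly i - 1; otherwise the result is not a partition.
addCol : ℕ → List ℕ → Maybe (List ℕ)
addCol i [] with i ℕ.≟ 1
... | yes _ = just (1 ∷ [])
... | no  _ = nothing
addCol i (r ∷ rs) with i ≤? r
... | yes _ = Maybe.map (r ∷_) (addCol i rs)
... | no  _ with suc r ℕ.≟ i
...   | yes _ = just (suc r ∷ rs)
...   | no  _ = nothing

headOr0 : List ℕ → ℕ
headOr0 []      = 0
headOr0 (r ∷ _) = r

shrinkRow : ℕ → List ℕ → List ℕ
shrinkRow zero    rs = rs
shrinkRow (suc k) rs = suc k ∷ rs

-- remove a box from column i (i ≥ 1): the last row of length ≥ i must have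
-- length exactly i; otherwise (or if column i is empty) the result is 0.
remCol : ℕ → List ℕ → Maybe (List ℕ)
remCol i [] = nothing
remCol i (r ∷ rs) with i ≤? headOr0 rs
... | yes _ = Maybe.map (r ∷_) (remCol i rs)
... | no  _ with r ℕ.≟ i
...   | yes _ = just (shrinkRow (r ∸ 1) rs)
...   | no  _ = nothing

-- The free ℤ[β]-module with basis the partitions.
-- An element is a formal finite sum  Σ c · β^k · λ  given as a list of
-- terms (c , k , λ); two elements are equal iff all coefficients agree.

Elem : Set
Elem = List (ℤ × ℕ × List ℕ)

coeff : List ℕ → ℕ → Elem → ℤ
coeff μ k [] = + 0
coeff μ k ((c , j , ν) ∷ v) with ≡-dec ℕ._≟_ μ ν | k ℕ.≟ j
... | yes _ | yes _ = c ℤ.+ coeff μ k v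
... | _     | _     = coeff μ k v

scale : ℤ → ℕ → Elem → Elem
scale c k = map (λ { (c' , j , ν) → (c ℤ.* c' , k + j , ν) })

basis : List ℕ → Elem
basis λ' = (+ 1 , 0 , λ') ∷ []

-- ℤ[β]-linear operators, given by their values on the basis
Op : Set
Op = List ℕ → Elem

apply : Op → Elem → Elem
apply O = concatMap (λ { (c , k , ν) → scale c k (O ν) })

_∘ₒ_ : Op → Op → Op
(O ∘ₒ P) μ = apply O (P μ)

idₒ : Op
idₒ = basis

zeroₒ : Op
zeroₒ _ = []

_+ₒ_ : Op → Op → Op
(O +ₒ P) μ = O μ ++ P μ

fromMaybe : Maybe (List ℕ) → Elem
fromMaybe = maybe basis []

u : ℕ → Op
u i μ = fromMaybe (addCol i μ)

d : ℕ → Op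
d i μ = fromMaybe (remCol i μ)

dPow : ℕ → ℕ → Op
dPow i zero    = idₒ
dPow i (suc k) = d i ∘ₒ dPow i k

size : List ℕ → ℕ
size = sum

uT : ℕ → Op
uT i = u i ∘ₒ (λ μ → basis μ ++ scale (- + 1) 1 (d i μ))

-- d̃_i = Σ_{k ≥ 1} β^{k-1} d_i^k.  On a partition μ, d_i^k μ = 0 for
-- k > |μ|, so the series is the finite sum over 1 ≤ k ≤ |μ|.
dT : ℕ → Op
dT i μ = concatMap (λ k → scale (+ 1) k (dPow i (suc k) μ)) (upTo (size μ))

-- Formal power series in central variables x, y with operator
-- coefficients:  S a b  is the coefficient of x^a y^b.

Ser : Set
Ser = ℕ → ℕ → Op

oneS : Ser
oneS zero zero = idₒ
oneS _    _    = zeroₒ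

mono : ℕ → ℕ → Op → Ser
mono a b O a' b' with a ℕ.≟ a' | b ℕ.≟ b'
... | yes _ | yes _ = O
... | _     | _     = zeroₒ

_+S_ : Ser → Ser → Ser
(S +S T) a b = S a b +ₒ T a b

sumOps : List Op → Op
sumOps = foldr _+ₒ_ zeroₒ

_*S_ : Ser → Ser → Ser
(S *S T) a b = sumOps (concatMap (λ a₁ → map (λ b₁ →
                  S a₁ b₁ ∘ₒ T (a ∸ a₁) (b ∸ b₁)) (upTo (suc b))) (upTo (suc a)))

powS : Ser → ℕ → Ser
powS S zero    = oneS
powS S (suc k) = S *S powS S k

-- (1 - S)^{-1} = Σ_{k ≥ 0} S^k, for S with zero constant term; then S^k
-- contributes to x^a y^b only when k ≤ a + b.
inv1m : Ser → Ser
inv1m S a b = sumOps (map (λ k → powS S k a b) (upTo (suc (a + b))))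

LHS : ℕ → Ser
LHS i = inv1m (mono 1 1 (uT i ∘ₒ dT i))
          *S ((oneS +S mono 1 0 (uT i)) *S (oneS +S mono 0 1 (dT (suc i))))

RHS : ℕ → Ser
RHS i = inv1m (mono 1 1 (dT (suc i) ∘ₒ uT (suc i)))
          *S ((oneS +S mono 0 1 (dT (suc i))) *S (oneS +S mono 1 0 (uT i)))

-- Write X = ũᵢd̃ᵢ and Y = d̃ᵢ₊₁ũᵢ₊₁. Expanding (1 − xyX)⁻¹ = Σₙ (xy)ⁿXⁿ, the coefficient of xᵃyᵇ on the
-- left is Xⁿ + Xⁿ⁻¹ũᵢd̃ᵢ₊₁ at a = b = n, Xⁿũᵢ at (n + 1, n), Xⁿd̃ᵢ₊₁ at (n, n + 1) and 0 elsewhere, and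
-- likewise on the right with Y. So it suffices that Xⁿ and Yⁿ agree on ũᵢλ and d̃ᵢ₊₁λ and that
-- Xⁿ⁺¹λ + Xⁿũᵢd̃ᵢ₊₁λ = Yⁿ⁺¹λ + Yⁿd̃ᵢ₊₁ũᵢλ.
--
-- All four operators only see columns i and i + 1, so λ is described by the numbers x, y, z of its rows
-- of lengths i + 1, i, i − 1. On partitions with y > 0 both X and Y are the identity (the factor 1 − βdᵢ
-- in ũᵢ makes ũᵢd̃ᵢ telescope, and likewise for d̃ᵢ₊₁ũᵢ₊₁); at y = 0, X vanishes and Y gives −βd̃ᵢ₊₁λ.
-- Moreover Xλ + ũᵢd̃ᵢ₊₁λ = Yλ + d̃ᵢ₊₁ũᵢλ. Every vector that occurs is supported on partitions with y > 0,
-- where Xⁿ and Yⁿ are both the identity, and the three relations follow.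
--
-- Elements of ℤ[β]P are lists of terms compared coefficientwise; every linear functional on lists factors
-- through the coefficients, which makes the operators well defined on the equivalence classes.

module Submission where

open import Defs
open import Data.Bool using (Bool; true; false; if_then_else_)
open import Data.Bool.Properties using (if-float)
open import Data.Empty using (⊥-elim)
open import Data.Integer using (ℤ; 0ℤ; 1ℤ; -1ℤ)
import Data.Integer as ℤ using (_+_; _*_)
import Data.Integer.Properties as ℤP
open import Data.Integer.Tactic.RingSolver using (solve-∀)
open import Data.List using (List; []; _∷_; _++_; map; concatMap; upTo; applyUpTo; length; replicate)
open import Data.List.Effectful using (module MonadProperties)
import Data.List.Properties as List
open import Data.List.Properties using (≡-dec)
open import Data.List.Relation.Unary.All as All using (All; []; _∷_)
import Data.List.Relation.Unary.All.Properties as All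
open import Data.Maybe using (just; nothing)
import Data.Maybe as Maybe
import Data.Maybe.Properties as Maybe
open import Data.Nat using (ℕ; zero; suc; _+_; _∸_; _≤_; _<_; z≤n; s≤s; _≤?_; pred)
import Data.Nat as ℕ
open import Data.Nat.ListAction using (sum)
import Data.Nat.ListAction.Properties as Sum
import Data.Nat.Properties as ℕP
import Data.Nat.Tactic.RingSolver as ℕ-Solver
open import Data.Product using (_×_; _,_; Σ-syntax)
open import Data.Sum using (_⊎_; inj₁; inj₂)
open import Relation.Binary using (Setoid; tri<; tri≈; tri>)
open import Relation.Binary.PropositionalEquality
import Relation.Binary.Reasoning.Setoid as SetoidReasoning
open import Relation.Nullary using (yes; no; ¬_; Dec)
open import Relation.Nullary.Decidable using (_×-dec_)

-- Coefficientwise equality of elements of ℤ[β]P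

Term : Set
Term = ℤ × ℕ × List ℕ

SameKey : List ℕ → ℕ → List ℕ → ℕ → Set
SameKey μ k ν j = μ ≡ ν × k ≡ j

sameKey? : ∀ μ k ν j → Dec (SameKey μ k ν j)
sameKey? μ k ν j = ≡-dec ℕ._≟_ μ ν ×-dec k ℕ.≟ j

coeff-∷-same : ∀ μ k c v → coeff μ k ((c , k , μ) ∷ v) ≡ c ℤ.+ coeff μ k v
coeff-∷-same μ k c v with ≡-dec ℕ._≟_ μ μ | k ℕ.≟ k
... | yes _ | yes _ = refl
... | yes _ | no k≢k = ⊥-elim (k≢k refl)
... | no μ≢μ | _ = ⊥-elim (μ≢μ refl)

coeff-∷-other : ∀ μ k c j ν v → ¬ SameKey μ k ν j → coeff μ k ((c , j , ν) ∷ v) ≡ coeff μ k v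
coeff-∷-other μ k c j ν v ne with ≡-dec ℕ._≟_ μ ν | k ℕ.≟ j
... | yes p | yes q = ⊥-elim (ne (p , q))
... | yes _ | no _ = refl
... | no _ | _ = refl

pairing : (ℕ → List ℕ → ℤ) → Elem → ℤ
pairing f [] = 0ℤ
pairing f ((c , j , ν) ∷ v) = c ℤ.* f j ν ℤ.+ pairing f v

delta : List ℕ → ℕ → ℕ → List ℕ → ℤ
delta μ k j ν with sameKey? μ k ν j
... | yes _ = 1ℤ
... | no _ = 0ℤ

coeff≡pairing-delta : ∀ μ k v → coeff μ k v ≡ pairing (delta μ k) v
coeff≡pairing-delta μ k [] = refl
coeff≡pairing-delta μ k ((c , j , ν) ∷ v) with sameKey? μ k ν j
... | yes (refl , refl) =
  trans (coeff-∷-same μ k c v) (cong₂ ℤ._+_ (sym (ℤP.*-identityʳ c)) (coeff≡pairing-delta μ k v))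
... | no ne =
  trans (coeff-∷-other μ k c j ν v ne)
    (trans (coeff≡pairing-delta μ k v) (sym (trans (cong (ℤ._+ _) (ℤP.*-zeroʳ c)) (ℤP.+-identityˡ _))))

pairing-++ : ∀ f v w → pairing f (v ++ w) ≡ pairing f v ℤ.+ pairing f w
pairing-++ f [] w = sym (ℤP.+-identityˡ _)
pairing-++ f ((c , j , ν) ∷ v) w =
  trans (cong (λ q → c ℤ.* f j ν ℤ.+ q) (pairing-++ f v w)) (sym (ℤP.+-assoc (c ℤ.* f j ν) _ _))

pairing-scale : ∀ f c j v → pairing f (scale c j v) ≡ c ℤ.* pairing (λ j' ν → f (j + j') ν) v
pairing-scale f c j [] = sym (ℤP.*-zeroʳ c)
pairing-scale f c j ((c' , j' , ν) ∷ v) =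
  trans (cong₂ ℤ._+_ (ℤP.*-assoc c c' _) (pairing-scale f c j v)) (sym (ℤP.*-distribˡ-+ c _ _))

coeff-++ : ∀ μ k v w → coeff μ k (v ++ w) ≡ coeff μ k v ℤ.+ coeff μ k w
coeff-++ μ k v w = trans (coeff≡pairing-delta μ k (v ++ w))
  (trans (pairing-++ _ v w) (sym (cong₂ ℤ._+_ (coeff≡pairing-delta μ k v) (coeff≡pairing-delta μ k w))))

coeff-scale : ∀ μ k c j v → coeff μ k (scale c j v) ≡ c ℤ.* pairing (λ j' ν → delta μ k (j + j') ν) v
coeff-scale μ k c j v = trans (coeff≡pairing-delta μ k (scale c j v)) (pairing-scale (delta μ k) c j v)

deleteKey : List ℕ → ℕ → Elem → Elem
deleteKey ν j [] = []
deleteKey ν j ((c , j' , ν') ∷ v) with sameKey? ν j ν' j'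
... | yes _ = deleteKey ν j v
... | no _ = (c , j' , ν') ∷ deleteKey ν j v

length-deleteKey : ∀ ν j v → length (deleteKey ν j v) ≤ length v
length-deleteKey ν j [] = z≤n
length-deleteKey ν j ((c , j' , ν') ∷ v) with sameKey? ν j ν' j'
... | yes _ = ℕP.m≤n⇒m≤1+n (length-deleteKey ν j v)
... | no _ = s≤s (length-deleteKey ν j v)

pairing-deleteKey : ∀ f ν j v → pairing f v ≡ coeff ν j v ℤ.* f j ν ℤ.+ pairing f (deleteKey ν j v)
pairing-deleteKey f ν j [] = refl
pairing-deleteKey f ν j ((c , j' , ν') ∷ v) with sameKey? ν j ν' j'
... | yes (refl , refl) = begin
    c ℤ.* f j ν ℤ.+ pairing f v
      ≡⟨ cong (λ q → c ℤ.* f j ν ℤ.+ q) (pairing-deleteKey f ν j v) ⟩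
    c ℤ.* f j ν ℤ.+ (coeff ν j v ℤ.* f j ν ℤ.+ pairing f (deleteKey ν j v))
      ≡⟨ collect c (coeff ν j v) (f j ν) _ ⟩
    (c ℤ.+ coeff ν j v) ℤ.* f j ν ℤ.+ pairing f (deleteKey ν j v)
      ≡⟨ cong (λ a → a ℤ.* f j ν ℤ.+ pairing f (deleteKey ν j v)) (sym (coeff-∷-same ν j c v)) ⟩
    coeff ν j ((c , j , ν) ∷ v) ℤ.* f j ν ℤ.+ pairing f (deleteKey ν j v) ∎
  where
  open ≡-Reasoning
  collect : ∀ a b x r → a ℤ.* x ℤ.+ (b ℤ.* x ℤ.+ r) ≡ (a ℤ.+ b) ℤ.* x ℤ.+ r
  collect = solve-∀
... | no ne = begin
    c ℤ.* f j' ν' ℤ.+ pairing f v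
      ≡⟨ cong (λ q → c ℤ.* f j' ν' ℤ.+ q) (pairing-deleteKey f ν j v) ⟩
    c ℤ.* f j' ν' ℤ.+ (coeff ν j v ℤ.* f j ν ℤ.+ pairing f (deleteKey ν j v))
      ≡⟨ swap (c ℤ.* f j' ν') (coeff ν j v ℤ.* f j ν) _ ⟩
    coeff ν j v ℤ.* f j ν ℤ.+ (c ℤ.* f j' ν' ℤ.+ pairing f (deleteKey ν j v))
      ≡⟨ cong (λ a → a ℤ.* f j ν ℤ.+ (c ℤ.* f j' ν' ℤ.+ pairing f (deleteKey ν j v))) (sym (coeff-∷-other ν j c j' ν' v ne)) ⟩
    coeff ν j ((c , j' , ν') ∷ v) ℤ.* f j ν ℤ.+ (c ℤ.* f j' ν' ℤ.+ pairing f (deleteKey ν j v)) ∎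
  where
  open ≡-Reasoning
  swap : ∀ a b r → a ℤ.+ (b ℤ.+ r) ≡ b ℤ.+ (a ℤ.+ r)
  swap = solve-∀

coeff-∷-cong : ∀ μ k t v w → coeff μ k v ≡ coeff μ k w → coeff μ k (t ∷ v) ≡ coeff μ k (t ∷ w)
coeff-∷-cong μ k (c , j , ν) v w eq with sameKey? μ k ν j
... | yes (refl , refl) = trans (coeff-∷-same μ k c v) (trans (cong (λ q → c ℤ.+ q) eq) (sym (coeff-∷-same μ k c w)))
... | no ne = trans (coeff-∷-other μ k c j ν v ne) (trans eq (sym (coeff-∷-other μ k c j ν w ne)))

coeff-deleteKey-same : ∀ ν j v → coeff ν j (deleteKey ν j v) ≡ 0ℤ
coeff-deleteKey-same ν j [] = refl
coeff-deleteKey-same ν j ((c , j' , ν') ∷ v) with sameKey? ν j ν' j'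
... | yes _ = coeff-deleteKey-same ν j v
... | no ne = trans (coeff-∷-other ν j c j' ν' _ ne) (coeff-deleteKey-same ν j v)

coeff-deleteKey-other : ∀ μ k ν j v → ¬ SameKey μ k ν j → coeff μ k (deleteKey ν j v) ≡ coeff μ k v
coeff-deleteKey-other μ k ν j [] ne = refl
coeff-deleteKey-other μ k ν j ((c , j' , ν') ∷ v) ne with sameKey? ν j ν' j'
... | yes (refl , refl) = trans (coeff-deleteKey-other μ k ν j v ne) (sym (coeff-∷-other μ k c j ν v ne))
... | no _ = coeff-∷-cong μ k _ _ _ (coeff-deleteKey-other μ k ν j v ne)

IsZero : Elem → Set
IsZero v = ∀ μ k → coeff μ k v ≡ 0ℤ

IsZero-deleteKey : ∀ ν j v → IsZero v → IsZero (deleteKey ν j v)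
IsZero-deleteKey ν j v z μ k with sameKey? μ k ν j
... | yes (refl , refl) = coeff-deleteKey-same ν j v
... | no ne = trans (coeff-deleteKey-other μ k ν j v ne) (z μ k)

-- Induction on a bound for the length, since deleting the key of the head term may shorten v by more than one.
pairing-IsZero : ∀ f n v → length v ≤ n → IsZero v → pairing f v ≡ 0ℤ
pairing-IsZero f n [] _ _ = refl
pairing-IsZero f (suc n) v@((c , j , ν) ∷ v') (s≤s len) z = begin
    pairing f v                                                ≡⟨ pairing-deleteKey f ν j v ⟩
    coeff ν j v ℤ.* f j ν ℤ.+ pairing f (deleteKey ν j v)     ≡⟨ cong₂ (λ a b → a ℤ.* f j ν ℤ.+ b) (z ν j) rest ⟩
    0ℤ                                                        ∎
  where
  open ≡-Reasoning
  shorter : length (deleteKey ν j v) ≤ n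
  shorter with sameKey? ν j ν j
  ... | yes _ = ℕP.≤-trans (length-deleteKey ν j v') len
  ... | no ne = ⊥-elim (ne (refl , refl))
  rest : pairing f (deleteKey ν j v) ≡ 0ℤ
  rest = pairing-IsZero f n (deleteKey ν j v) shorter (IsZero-deleteKey ν j v z)

infix 4 _≈_
record _≈_ (v w : Elem) : Set where
  constructor mk≈
  field coeff-≡ : ∀ μ k → coeff μ k v ≡ coeff μ k w
open _≈_ public

≈-refl : ∀ {v} → v ≈ v
≈-refl = mk≈ λ _ _ → refl

≈-sym : ∀ {v w} → v ≈ w → w ≈ v
≈-sym e = mk≈ λ μ k → sym (coeff-≡ e μ k)

≈-trans : ∀ {u v w} → u ≈ v → v ≈ w → u ≈ w
≈-trans e f = mk≈ λ μ k → trans (coeff-≡ e μ k) (coeff-≡ f μ k)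

≡⇒≈ : ∀ {v w} → v ≡ w → v ≈ w
≡⇒≈ refl = ≈-refl

≈-setoid : Setoid _ _
≈-setoid = record
  { Carrier = Elem ; _≈_ = _≈_
  ; isEquivalence = record { refl = ≈-refl ; sym = ≈-sym ; trans = ≈-trans } }

module ≈-Reasoning = SetoidReasoning ≈-setoid

negate : Elem → Elem
negate = scale -1ℤ 0

coeff-negate : ∀ μ k v → coeff μ k (negate v) ≡ -1ℤ ℤ.* coeff μ k v
coeff-negate μ k v = trans (coeff-scale μ k -1ℤ 0 v) (cong (-1ℤ ℤ.*_) (sym (coeff≡pairing-delta μ k v)))

-- Since coeff μ k = pairing (delta μ k), this makes scale and apply well defined on ≈-classes.
pairing-resp-≈ : ∀ f {v w} → v ≈ w → pairing f v ≡ pairing f w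
pairing-resp-≈ f {v} {w} v≈w = cancel (pairing f v) (pairing f w) difference
  where
  open ≡-Reasoning
  difference : pairing f v ℤ.+ -1ℤ ℤ.* pairing f w ≡ 0ℤ
  difference = begin
    pairing f v ℤ.+ -1ℤ ℤ.* pairing f w   ≡⟨ sym (trans (pairing-++ f v (negate w)) (cong (λ q → pairing f v ℤ.+ q) (pairing-scale f -1ℤ 0 w))) ⟩
    pairing f (v ++ negate w)               ≡⟨ pairing-IsZero f _ (v ++ negate w) ℕP.≤-refl isZero ⟩
    0ℤ                                     ∎
    where
    inverse : ∀ x → x ℤ.+ -1ℤ ℤ.* x ≡ 0ℤ
    inverse = solve-∀
    isZero : IsZero (v ++ negate w)
    isZero μ k = trans (coeff-++ μ k v (negate w))
      (trans (cong₂ ℤ._+_ (coeff-≡ v≈w μ k) (coeff-negate μ k w)) (inverse (coeff μ k w)))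
  cancel : ∀ a b → a ℤ.+ -1ℤ ℤ.* b ≡ 0ℤ → a ≡ b
  cancel a b h = begin
    a                              ≡⟨ split a b ⟩
    (a ℤ.+ -1ℤ ℤ.* b) ℤ.+ b      ≡⟨ cong (ℤ._+ b) h ⟩
    0ℤ ℤ.+ b                      ≡⟨ ℤP.+-identityˡ b ⟩
    b                              ∎
    where
    split : ∀ a b → a ≡ (a ℤ.+ -1ℤ ℤ.* b) ℤ.+ b
    split = solve-∀

++-cong : ∀ {a b c d} → a ≈ b → c ≈ d → a ++ c ≈ b ++ d
++-cong {a} {b} {c} {d} a≈b c≈d = mk≈ λ μ k →
  trans (coeff-++ μ k a c) (trans (cong₂ ℤ._+_ (coeff-≡ a≈b μ k) (coeff-≡ c≈d μ k)) (sym (coeff-++ μ k b d)))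

++-comm : ∀ a b → a ++ b ≈ b ++ a
++-comm a b = mk≈ λ μ k →
  trans (coeff-++ μ k a b) (trans (ℤP.+-comm (coeff μ k a) (coeff μ k b)) (sym (coeff-++ μ k b a)))

++-identityʳ : ∀ a → a ++ [] ≈ a
++-identityʳ a = ≡⇒≈ (List.++-identityʳ a)

++-interchange : ∀ a b c d → (a ++ b) ++ (c ++ d) ≈ (a ++ c) ++ (b ++ d)
++-interchange a b c d = mk≈ λ μ k → begin
    coeff μ k ((a ++ b) ++ (c ++ d))
      ≡⟨ trans (coeff-++ μ k (a ++ b) (c ++ d)) (cong₂ ℤ._+_ (coeff-++ μ k a b) (coeff-++ μ k c d)) ⟩
    (coeff μ k a ℤ.+ coeff μ k b) ℤ.+ (coeff μ k c ℤ.+ coeff μ k d)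
      ≡⟨ middle-swap (coeff μ k a) (coeff μ k b) (coeff μ k c) (coeff μ k d) ⟩
    (coeff μ k a ℤ.+ coeff μ k c) ℤ.+ (coeff μ k b ℤ.+ coeff μ k d)
      ≡⟨ sym (trans (coeff-++ μ k (a ++ c) (b ++ d)) (cong₂ ℤ._+_ (coeff-++ μ k a c) (coeff-++ μ k b d))) ⟩
    coeff μ k ((a ++ c) ++ (b ++ d)) ∎
  where
  open ≡-Reasoning
  middle-swap : ∀ x y z w → (x ℤ.+ y) ℤ.+ (z ℤ.+ w) ≡ (x ℤ.+ z) ℤ.+ (y ℤ.+ w)
  middle-swap = solve-∀

++-cong-crossed : ∀ p s p' s' {q r q' r'} → p ++ s ≈ p' ++ s' → q ≈ r' → r ≈ q' →
  (p ++ q) ++ (r ++ s) ≈ (p' ++ q') ++ (r' ++ s')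
++-cong-crossed p s p' s' {q} {r} {q'} {r'} ps≈ q≈ r≈ = begin
  (p ++ q) ++ (r ++ s)        ≈⟨ ++-cong (++-comm p q) (≈-refl {r ++ s}) ⟩
  (q ++ p) ++ (r ++ s)        ≈⟨ ++-interchange q p r s ⟩
  (q ++ r) ++ (p ++ s)        ≈⟨ ++-comm (q ++ r) (p ++ s) ⟩
  (p ++ s) ++ (q ++ r)        ≈⟨ ++-cong ps≈ (++-cong q≈ r≈) ⟩
  (p' ++ s') ++ (r' ++ q')    ≈⟨ ++-cong (≈-refl {p' ++ s'}) (++-comm r' q') ⟩
  (p' ++ s') ++ (q' ++ r')    ≈⟨ ++-interchange p' s' q' r' ⟩
  (p' ++ q') ++ (s' ++ r')    ≈⟨ ++-cong (≈-refl {p' ++ q'}) (++-comm s' r') ⟩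
  (p' ++ q') ++ (r' ++ s')    ∎
  where open ≈-Reasoning

scale-cong : ∀ c j {v w} → v ≈ w → scale c j v ≈ scale c j w
scale-cong c j {v} {w} v≈w = mk≈ λ μ k →
  trans (coeff-scale μ k c j v) (trans (cong (c ℤ.*_) (pairing-resp-≈ _ v≈w)) (sym (coeff-scale μ k c j w)))

scale-+ : ∀ c c' j v → scale c j v ++ scale c' j v ≈ scale (c ℤ.+ c') j v
scale-+ c c' j v = mk≈ λ μ k →
  trans (coeff-++ μ k (scale c j v) (scale c' j v))
  (trans (cong₂ ℤ._+_ (coeff-scale μ k c j v) (coeff-scale μ k c' j v))
  (trans (sym (ℤP.*-distribʳ-+ _ c c')) (sym (coeff-scale μ k (c ℤ.+ c') j v))))

scale-zero : ∀ j v → scale 0ℤ j v ≈ []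
scale-zero j v = mk≈ λ μ k → coeff-scale μ k 0ℤ j v

scale-++ : ∀ c j v w → scale c j (v ++ w) ≡ scale c j v ++ scale c j w
scale-++ c j = List.map-++ _

scale-scale : ∀ c j c' j' v → scale c j (scale c' j' v) ≡ scale (c ℤ.* c') (j + j') v
scale-scale c j c' j' [] = refl
scale-scale c j c' j' ((c'' , j'' , ν) ∷ v) =
  cong₂ _∷_ (cong₂ (λ a b → a , b , ν) (sym (ℤP.*-assoc c c' c'')) (sym (ℕP.+-assoc j j' j'')))
            (scale-scale c j c' j' v)

scale-one : ∀ v → scale 1ℤ 0 v ≡ v
scale-one [] = refl
scale-one ((c , j , ν) ∷ v) = cong₂ _∷_ (cong (λ a → a , j , ν) (ℤP.*-identityˡ c)) (scale-one v)

scale-concatMap : ∀ {A : Set} c j (f : A → Elem) xs →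
  scale c j (concatMap f xs) ≡ concatMap (λ x → scale c j (f x)) xs
scale-concatMap c j f = List.map-concatMap _ f

-- Operators and operator-valued power series

infix 4 _≈ₒ_
_≈ₒ_ : Op → Op → Set
O ≈ₒ P = ∀ ν → O ν ≈ P ν

apply-++ : ∀ O v w → apply O (v ++ w) ≡ apply O v ++ apply O w
apply-++ O = List.concatMap-++ _

apply-scale : ∀ O c j v → apply O (scale c j v) ≡ scale c j (apply O v)
apply-scale O c j [] = refl
apply-scale O c j ((c' , j' , ν) ∷ v) =
  trans (cong₂ _++_ (sym (scale-scale c j c' j' (O ν))) (apply-scale O c j v))
        (sym (scale-++ c j (scale c' j' (O ν)) (apply O v)))

apply-basis : ∀ O ν → apply O (basis ν) ≡ O ν
apply-basis O ν = trans (List.++-identityʳ _) (scale-one (O ν))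

apply-id : ∀ v → apply idₒ v ≡ v
apply-id [] = refl
apply-id ((c , j , ν) ∷ v) =
  cong₂ _∷_ (cong₂ (λ a b → a , b , ν) (ℤP.*-identityʳ c) (ℕP.+-identityʳ j)) (apply-id v)

apply-zero : ∀ v → apply zeroₒ v ≡ []
apply-zero [] = refl
apply-zero (_ ∷ v) = apply-zero v

apply-∘ : ∀ O P v → apply (O ∘ₒ P) v ≡ apply O (apply P v)
apply-∘ O P [] = refl
apply-∘ O P ((c , j , ν) ∷ v) =
  trans (cong₂ _++_ (sym (apply-scale O c j (P ν))) (apply-∘ O P v))
        (sym (apply-++ O (scale c j (P ν)) (apply P v)))

coeff-apply : ∀ O μ k v → coeff μ k (apply O v) ≡ pairing (λ j ν → pairing (λ j' ν' → delta μ k (j + j') ν') (O ν)) v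
coeff-apply O μ k [] = refl
coeff-apply O μ k ((c , j , ν) ∷ v) =
  trans (coeff-++ μ k (scale c j (O ν)) (apply O v)) (cong₂ ℤ._+_ (coeff-scale μ k c j (O ν)) (coeff-apply O μ k v))

apply-cong : ∀ O {v w} → v ≈ w → apply O v ≈ apply O w
apply-cong O {v} {w} v≈w = mk≈ λ μ k →
  trans (coeff-apply O μ k v) (trans (pairing-resp-≈ _ v≈w) (sym (coeff-apply O μ k w)))

basisOf : Term → List ℕ
basisOf (_ , _ , ν) = ν

apply-cong-on : ∀ {O P} v → All (λ t → O (basisOf t) ≈ P (basisOf t)) v → apply O v ≈ apply P v
apply-cong-on [] [] = ≈-refl
apply-cong-on ((c , j , ν) ∷ v) (O≈P ∷ rest) = ++-cong (scale-cong c j O≈P) (apply-cong-on v rest)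

apply-congˡ : ∀ {O P} → O ≈ₒ P → ∀ v → apply O v ≈ apply P v
apply-congˡ O≈P v = apply-cong-on v (All.universal (λ t → O≈P (basisOf t)) v)

apply-+ₒ : ∀ O P v → apply (O +ₒ P) v ≈ apply O v ++ apply P v
apply-+ₒ O P [] = ≈-refl
apply-+ₒ O P ((c , j , ν) ∷ v) =
  ≈-trans (++-cong (≡⇒≈ (scale-++ c j (O ν) (P ν))) (apply-+ₒ O P v))
          (++-interchange (scale c j (O ν)) (scale c j (P ν)) (apply O v) (apply P v))

concatMap-cong : ∀ {A : Set} {f g : A → Elem} → (∀ x → f x ≈ g x) → ∀ xs → concatMap f xs ≈ concatMap g xs
concatMap-cong f≈g [] = ≈-refl
concatMap-cong f≈g (x ∷ xs) = ++-cong (f≈g x) (concatMap-cong f≈g xs)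

concatMap-++ : ∀ {A : Set} (f g : A → Elem) xs → concatMap (λ x → f x ++ g x) xs ≈ concatMap f xs ++ concatMap g xs
concatMap-++ f g [] = ≈-refl
concatMap-++ f g (x ∷ xs) =
  ≈-trans (++-cong (≈-refl {f x ++ g x}) (concatMap-++ f g xs))
          (++-interchange (f x) (g x) (concatMap f xs) (concatMap g xs))

concatMap-upTo-suc : ∀ (f : ℕ → Elem) n → concatMap f (upTo (suc n)) ≈ concatMap f (upTo n) ++ f n
concatMap-upTo-suc f n = ≈-trans
  (≡⇒≈ (trans (cong (concatMap f) (sym (List.upTo-∷ʳ n))) (List.concatMap-++ f (upTo n) (n ∷ []))))
  (++-cong (≈-refl {concatMap f (upTo n)}) (++-identityʳ (f n)))

concatMap-upTo-zero : ∀ (f : ℕ → Elem) n → (∀ k → k < n → f k ≈ []) → concatMap f (upTo n) ≈ []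
concatMap-upTo-zero f zero vanish = ≈-refl
concatMap-upTo-zero f (suc n) vanish = ≈-trans (concatMap-upTo-suc f n)
  (++-cong (concatMap-upTo-zero f n (λ k k<n → vanish k (ℕP.m<n⇒m<1+n k<n))) (vanish n ℕP.≤-refl))

concatMap-upTo-single : ∀ (f : ℕ → Elem) m n → m < n → (∀ k → k < n → k ≢ m → f k ≈ []) →
  concatMap f (upTo n) ≈ f m
concatMap-upTo-single f m (suc n) m<1+n vanish with ℕP.m≤n⇒m<n∨m≡n (ℕP.≤-pred m<1+n)
... | inj₁ m<n = ≈-trans (concatMap-upTo-suc f n) (≈-trans
  (++-cong (concatMap-upTo-single f m n m<n (λ k k<n → vanish k (ℕP.m<n⇒m<1+n k<n)))
           (vanish n ℕP.≤-refl (λ n≡m → ℕP.<⇒≢ m<n (sym n≡m))))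
  (++-identityʳ (f m)))
... | inj₂ refl = ≈-trans (concatMap-upTo-suc f n)
  (++-cong (concatMap-upTo-zero f n (λ k k<n → vanish k (ℕP.m<n⇒m<1+n k<n) (ℕP.<⇒≢ k<n))) (≈-refl {f m}))

infix 4 _≈S_
_≈S_ : Ser → Ser → Set
S ≈S T = ∀ a b → S a b ≈ₒ T a b

𝟙 : Ser
𝟙 = mono 0 0 idₒ

oneS≡𝟙 : ∀ a b → oneS a b ≡ 𝟙 a b
oneS≡𝟙 zero zero = refl
oneS≡𝟙 zero (suc b) = refl
oneS≡𝟙 (suc a) b = refl

sumOps-apply : ∀ Os ν → sumOps Os ν ≡ concatMap (λ O → O ν) Os
sumOps-apply [] ν = refl
sumOps-apply (O ∷ Os) ν = cong (O ν ++_) (sumOps-apply Os ν)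

*S-unfold : ∀ S T a b ν → (S *S T) a b ν ≡
  concatMap (λ a₁ → concatMap (λ b₁ → apply (S a₁ b₁) (T (a ∸ a₁) (b ∸ b₁) ν)) (upTo (suc b))) (upTo (suc a))
*S-unfold S T a b ν = begin
    sumOps (concatMap row (upTo (suc a))) ν
      ≡⟨ sumOps-apply (concatMap row (upTo (suc a))) ν ⟩
    concatMap (λ O → O ν) (concatMap row (upTo (suc a)))
      ≡⟨ sym (MonadProperties.associative (upTo (suc a)) row (λ O → O ν)) ⟩
    concatMap (λ a₁ → concatMap (λ O → O ν) (row a₁)) (upTo (suc a))
      ≡⟨ List.concatMap-cong (λ a₁ → List.concatMap-map (λ O → O ν) _ (upTo (suc b))) (upTo (suc a)) ⟩
    concatMap (λ a₁ → concatMap (λ b₁ → apply (S a₁ b₁) (T (a ∸ a₁) (b ∸ b₁) ν)) (upTo (suc b))) (upTo (suc a)) ∎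
  where
  open ≡-Reasoning
  row : ℕ → List Op
  row a₁ = map (λ b₁ → S a₁ b₁ ∘ₒ T (a ∸ a₁) (b ∸ b₁)) (upTo (suc b))

mono-same : ∀ a b O → mono a b O a b ≡ O
mono-same a b O with a ℕ.≟ a | b ℕ.≟ b
... | yes _ | yes _ = refl
... | yes _ | no b≢b = ⊥-elim (b≢b refl)
... | no a≢a | _ = ⊥-elim (a≢a refl)

mono-other : ∀ a b O a' b' → ¬ (a ≡ a' × b ≡ b') → mono a b O a' b' ≡ zeroₒ
mono-other a b O a' b' ne with a ℕ.≟ a' | b ℕ.≟ b'
... | yes p | yes q = ⊥-elim (ne (p , q))
... | yes _ | no _ = refl
... | no _ | _ = refl

mono-congₒ : ∀ a b {O P} → O ≈ₒ P → mono a b O ≈S mono a b P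
mono-congₒ a b O≈P a' b' with a ℕ.≟ a' | b ℕ.≟ b'
... | yes _ | yes _ = O≈P
... | yes _ | no _ = λ _ → ≈-refl
... | no _ | _ = λ _ → ≈-refl

*S-mono-at : ∀ S p q P a b ν → (S *S mono p q P) (p + a) (q + b) ν ≈ apply (S a b) (P ν)
*S-mono-at S p q P a b ν = ≈-trans (≡⇒≈ (*S-unfold S (mono p q P) (p + a) (q + b) ν))
  (≈-trans (concatMap-upTo-single _ a (suc (p + a)) (s≤s (ℕP.m≤n+m a p)) other-row)
  (≈-trans (concatMap-upTo-single _ b (suc (q + b)) (s≤s (ℕP.m≤n+m b q)) other-column)
  (≡⇒≈ (trans (cong₂ (λ a' b' → apply (S a b) (mono p q P a' b' ν)) (ℕP.m+n∸n≡m p a) (ℕP.m+n∸n≡m q b))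
               (cong (λ O → apply (S a b) (O ν)) (mono-same p q P))))))
  where
  offset : ∀ p a k → k ≤ p + a → p + a ∸ k ≡ p → k ≡ a
  offset p a k k≤ eq = ℕP.+-cancelˡ-≡ p k a (trans (cong (_+ k) (sym eq)) (ℕP.m∸n+n≡m k≤))
  vanishes : ∀ k l → ¬ (p ≡ p + a ∸ k × q ≡ q + b ∸ l) → apply (S k l) (mono p q P (p + a ∸ k) (q + b ∸ l) ν) ≈ []
  vanishes k l ne = ≡⇒≈ (cong (λ O → apply (S k l) (O ν)) (mono-other p q P _ _ ne))
  other-row : ∀ k → k < suc (p + a) → k ≢ a → _ ≈ []
  other-row k k< k≢a = concatMap-upTo-zero _ (suc (q + b))
    (λ l _ → vanishes k l (λ { (eq , _) → k≢a (offset p a k (ℕP.≤-pred k<) (sym eq)) }))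
  other-column : ∀ l → l < suc (q + b) → l ≢ b → _ ≈ []
  other-column l l< l≢b = vanishes a l (λ { (_ , eq) → l≢b (offset q b l (ℕP.≤-pred l<) (sym eq)) })

*S-mono-below : ∀ S p q P a b ν → ¬ (p ≤ a × q ≤ b) → (S *S mono p q P) a b ν ≈ []
*S-mono-below S p q P a b ν ne = ≈-trans (≡⇒≈ (*S-unfold S (mono p q P) a b ν))
  (concatMap-upTo-zero _ (suc a) λ a₁ _ → concatMap-upTo-zero _ (suc b) λ b₁ _ →
    ≡⇒≈ (cong (λ O → apply (S a₁ b₁) (O ν)) (mono-other p q P _ _ λ { (e₁ , e₂) →
      ne (subst (_≤ a) (sym e₁) (ℕP.m∸n≤m a a₁) , subst (_≤ b) (sym e₂) (ℕP.m∸n≤m b b₁)) })))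

*S-congʳ : ∀ S {T T'} → T ≈S T' → S *S T ≈S S *S T'
*S-congʳ S {T} {T'} T≈T' a b ν = ≈-trans (≡⇒≈ (*S-unfold S T a b ν)) (≈-trans
  (concatMap-cong (λ a₁ → concatMap-cong (λ b₁ → apply-cong (S a₁ b₁) (T≈T' (a ∸ a₁) (b ∸ b₁) ν)) (upTo (suc b))) (upTo (suc a)))
  (≡⇒≈ (sym (*S-unfold S T' a b ν))))

*S-congˡ : ∀ {S S'} T → S ≈S S' → S *S T ≈S S' *S T
*S-congˡ {S} {S'} T S≈S' a b ν = ≈-trans (≡⇒≈ (*S-unfold S T a b ν)) (≈-trans
  (concatMap-cong (λ a₁ → concatMap-cong (λ b₁ → apply-congˡ (S≈S' a₁ b₁) (T (a ∸ a₁) (b ∸ b₁) ν)) (upTo (suc b))) (upTo (suc a)))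
  (≡⇒≈ (sym (*S-unfold S' T a b ν))))

*S-distribˡ-+S : ∀ S T R a b ν → (S *S (T +S R)) a b ν ≈ (S *S T) a b ν ++ (S *S R) a b ν
*S-distribˡ-+S S T R a b ν = ≈-trans (≡⇒≈ (*S-unfold S (T +S R) a b ν)) (≈-trans
  (concatMap-cong (λ a₁ → ≈-trans
     (concatMap-cong (λ b₁ → ≡⇒≈ (apply-++ (S a₁ b₁) (T (a ∸ a₁) (b ∸ b₁) ν) (R (a ∸ a₁) (b ∸ b₁) ν))) (upTo (suc b)))
     (concatMap-++ (entry T a₁) (entry R a₁) (upTo (suc b)))) (upTo (suc a)))
  (≈-trans (concatMap-++ (row T) (row R) (upTo (suc a)))
  (++-cong (≡⇒≈ (sym (*S-unfold S T a b ν))) (≡⇒≈ (sym (*S-unfold S R a b ν))))))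
  where
  entry : Ser → ℕ → ℕ → Elem
  entry T a₁ b₁ = apply (S a₁ b₁) (T (a ∸ a₁) (b ∸ b₁) ν)
  row : Ser → ℕ → Elem
  row T a₁ = concatMap (entry T a₁) (upTo (suc b))

*S-distribʳ-+S : ∀ S T R a b ν → ((S +S T) *S R) a b ν ≈ (S *S R) a b ν ++ (T *S R) a b ν
*S-distribʳ-+S S T R a b ν = ≈-trans (≡⇒≈ (*S-unfold (S +S T) R a b ν)) (≈-trans
  (concatMap-cong (λ a₁ → ≈-trans
     (concatMap-cong (λ b₁ → apply-+ₒ (S a₁ b₁) (T a₁ b₁) (R (a ∸ a₁) (b ∸ b₁) ν)) (upTo (suc b)))
     (concatMap-++ (entry S a₁) (entry T a₁) (upTo (suc b)))) (upTo (suc a)))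
  (≈-trans (concatMap-++ (row S) (row T) (upTo (suc a)))
  (++-cong (≡⇒≈ (sym (*S-unfold S R a b ν))) (≡⇒≈ (sym (*S-unfold T R a b ν))))))
  where
  entry : Ser → ℕ → ℕ → Elem
  entry S a₁ b₁ = apply (S a₁ b₁) (R (a ∸ a₁) (b ∸ b₁) ν)
  row : Ser → ℕ → Elem
  row S a₁ = concatMap (entry S a₁) (upTo (suc b))

mono-shift : ∀ a b Q a' b' m n → mono (a + a') (b + b') Q (a' + m) (b' + n) ≡ mono a b Q m n
mono-shift a b Q a' b' m n = compare (a ℕ.≟ m) (b ℕ.≟ n)
  where
  compare : Dec (a ≡ m) → Dec (b ≡ n) → mono (a + a') (b + b') Q (a' + m) (b' + n) ≡ mono a b Q m n
  compare (yes refl) (yes refl) =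
    trans (cong₂ (mono (a + a') (b + b') Q) (ℕP.+-comm a' a) (ℕP.+-comm b' b))
          (trans (mono-same (a + a') (b + b') Q) (sym (mono-same a b Q)))
  compare _ (no b≢n) =
    trans (mono-other (a + a') (b + b') Q (a' + m) (b' + n) λ { (_ , eq) → b≢n (ℕP.+-cancelʳ-≡ b' b n (trans eq (ℕP.+-comm b' n))) })
          (sym (mono-other a b Q m n λ { (_ , eq) → b≢n eq }))
  compare (no a≢m) _ =
    trans (mono-other (a + a') (b + b') Q (a' + m) (b' + n) λ { (eq , _) → a≢m (ℕP.+-cancelʳ-≡ a' a m (trans eq (ℕP.+-comm a' m))) })
          (sym (mono-other a b Q m n λ { (eq , _) → a≢m eq }))

apply-mono : ∀ a b O P m n ν → apply (mono a b O m n) (P ν) ≡ mono a b (O ∘ₒ P) m n ν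
apply-mono a b O P m n ν with a ℕ.≟ m | b ℕ.≟ n
... | yes _ | yes _ = refl
... | yes _ | no _ = apply-zero (P ν)
... | no _ | _ = apply-zero (P ν)

mono-*S-mono : ∀ a b O a' b' P → mono a b O *S mono a' b' P ≈S mono (a + a') (b + b') (O ∘ₒ P)
mono-*S-mono a b O a' b' P x y ν with a' ≤? x | b' ≤? y
... | yes a'≤x | yes b'≤y =
  subst₂ (λ x y → (mono a b O *S mono a' b' P) x y ν ≈ mono (a + a') (b + b') (O ∘ₒ P) x y ν)
    (ℕP.m+[n∸m]≡n a'≤x) (ℕP.m+[n∸m]≡n b'≤y)
    (≈-trans (*S-mono-at (mono a b O) a' b' P (x ∸ a') (y ∸ b') ν)
      (≡⇒≈ (trans (apply-mono a b O P _ _ ν) (cong (λ Q → Q ν) (sym (mono-shift a b (O ∘ₒ P) a' b' _ _))))))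
... | yes _ | no b'≰y = ≈-trans (*S-mono-below (mono a b O) a' b' P x y ν λ { (_ , b'≤y) → b'≰y b'≤y })
  (≡⇒≈ (cong (λ Q → Q ν) (sym (mono-other (a + a') (b + b') (O ∘ₒ P) x y λ { (_ , eq) → b'≰y (subst (b' ≤_) eq (ℕP.m≤n+m b' b)) }))))
... | no a'≰x | _ = ≈-trans (*S-mono-below (mono a b O) a' b' P x y ν λ { (a'≤x , _) → a'≰x a'≤x })
  (≡⇒≈ (cong (λ Q → Q ν) (sym (mono-other (a + a') (b + b') (O ∘ₒ P) x y λ { (eq , _) → a'≰x (subst (a' ≤_) eq (ℕP.m≤n+m a' a)) }))))

𝟙-*S-mono : ∀ p q A → 𝟙 *S mono p q A ≈S mono p q A
𝟙-*S-mono p q A a b ν = ≈-trans (mono-*S-mono 0 0 idₒ p q A a b ν)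
  (mono-congₒ p q (λ ν → ≡⇒≈ (apply-id (A ν))) a b ν)

mono-*S-𝟙 : ∀ p q A → mono p q A *S 𝟙 ≈S mono p q A
mono-*S-𝟙 p q A a b ν = ≈-trans (mono-*S-mono p q A 0 0 idₒ a b ν)
  (subst₂ (λ p' q' → mono p' q' (A ∘ₒ idₒ) a b ν ≈ mono p q A a b ν) (sym (ℕP.+-identityʳ p)) (sym (ℕP.+-identityʳ q))
    (mono-congₒ p q (λ ν → ≡⇒≈ (apply-basis A ν)) a b ν))

_^ₒ_ : Op → ℕ → Op
X ^ₒ zero = idₒ
X ^ₒ suc n = X ∘ₒ (X ^ₒ n)

^ₒ-sucʳ : ∀ X n ν → (X ^ₒ suc n) ν ≈ apply (X ^ₒ n) (X ν)
^ₒ-sucʳ X zero ν = ≡⇒≈ (trans (apply-basis X ν) (sym (apply-id (X ν))))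
^ₒ-sucʳ X (suc n) ν = ≈-trans (apply-cong X (^ₒ-sucʳ X n ν)) (≡⇒≈ (sym (apply-∘ X (X ^ₒ n) (X ν))))

powS-xy : ∀ X n → powS (mono 1 1 X) n ≈S mono n n (X ^ₒ n)
powS-xy X zero a b ν = ≡⇒≈ (cong (λ O → O ν) (oneS≡𝟙 a b))
powS-xy X (suc n) a b ν =
  ≈-trans (*S-congʳ (mono 1 1 X) (powS-xy X n) a b ν) (mono-*S-mono 1 1 X n n (X ^ₒ n) a b ν)

inv1m-unfold : ∀ S a b ν → inv1m S a b ν ≡ concatMap (λ k → powS S k a b ν) (upTo (suc (a + b)))
inv1m-unfold S a b ν = trans (sumOps-apply (map (λ k → powS S k a b) (upTo (suc (a + b)))) ν)
  (List.concatMap-map (λ O → O ν) (λ k → powS S k a b) (upTo (suc (a + b))))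

inv1m-xy-diagonal : ∀ X n → inv1m (mono 1 1 X) n n ≈ₒ X ^ₒ n
inv1m-xy-diagonal X n ν = ≈-trans (≡⇒≈ (inv1m-unfold (mono 1 1 X) n n ν))
  (≈-trans (concatMap-cong (λ k → powS-xy X k n n ν) (upTo (suc (n + n))))
  (≈-trans (concatMap-upTo-single (λ k → mono k k (X ^ₒ k) n n ν) n (suc (n + n)) (s≤s (ℕP.m≤m+n n n))
             (λ k _ k≢n → ≡⇒≈ (cong (λ O → O ν) (mono-other k k (X ^ₒ k) n n λ { (eq , _) → k≢n eq }))))
  (≡⇒≈ (cong (λ O → O ν) (mono-same n n (X ^ₒ n))))))

inv1m-xy-offDiagonal : ∀ X m n → m ≢ n → inv1m (mono 1 1 X) m n ≈ₒ zeroₒ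
inv1m-xy-offDiagonal X m n m≢n ν = ≈-trans (≡⇒≈ (inv1m-unfold (mono 1 1 X) m n ν))
  (≈-trans (concatMap-cong (λ k → powS-xy X k m n ν) (upTo (suc (m + n))))
  (concatMap-upTo-zero (λ k → mono k k (X ^ₒ k) m n ν) (suc (m + n))
    (λ k _ → ≡⇒≈ (cong (λ O → O ν) (mono-other k k (X ^ₒ k) m n λ { (e₁ , e₂) → m≢n (trans (sym e₁) e₂) })))))

inv1m-xy-apply-cong : ∀ X Y m n v → (m ≡ n → apply (X ^ₒ m) v ≈ apply (Y ^ₒ m) v) →
  apply (inv1m (mono 1 1 X) m n) v ≈ apply (inv1m (mono 1 1 Y) m n) v
inv1m-xy-apply-cong X Y m n v agree with m ℕ.≟ n
... | yes refl = ≈-trans (apply-congˡ (inv1m-xy-diagonal X m) v)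
                 (≈-trans (agree refl) (≈-sym (apply-congˡ (inv1m-xy-diagonal Y m) v)))
... | no m≢n = ≈-trans (apply-congˡ (inv1m-xy-offDiagonal X m n m≢n) v)
               (≈-trans (≡⇒≈ (trans (apply-zero v) (sym (apply-zero v))))
                        (≈-sym (apply-congˡ (inv1m-xy-offDiagonal Y m n m≢n) v)))

oneS≈𝟙 : oneS ≈S 𝟙
oneS≈𝟙 a b ν = ≡⇒≈ (cong (λ O → O ν) (oneS≡𝟙 a b))

binomial-product : ∀ p q A p' q' B → (oneS +S mono p q A) *S (oneS +S mono p' q' B) ≈S
  (𝟙 +S mono p q A) +S (mono p' q' B +S mono (p + p') (q + q') (A ∘ₒ B))
binomial-product p q A p' q' B a b ν = begin
    (L *S (oneS +S N)) a b ν                          ≈⟨ *S-distribˡ-+S L oneS N a b ν ⟩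
    (L *S oneS) a b ν ++ (L *S N) a b ν               ≈⟨ ++-cong (*S-congʳ L oneS≈𝟙 a b ν) ≈-refl ⟩
    (L *S 𝟙) a b ν ++ (L *S N) a b ν                  ≈⟨ ++-cong (*S-distribʳ-+S oneS M 𝟙 a b ν) (*S-distribʳ-+S oneS M N a b ν) ⟩
    ((oneS *S 𝟙) a b ν ++ (M *S 𝟙) a b ν) ++ ((oneS *S N) a b ν ++ (M *S N) a b ν)
      ≈⟨ ++-cong (++-cong (≈-trans (*S-congˡ 𝟙 oneS≈𝟙 a b ν) (𝟙-*S-mono 0 0 idₒ a b ν)) (mono-*S-𝟙 p q A a b ν))
                 (++-cong (≈-trans (*S-congˡ N oneS≈𝟙 a b ν) (𝟙-*S-mono p' q' B a b ν)) (mono-*S-mono p q A p' q' B a b ν)) ⟩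
    (𝟙 a b ν ++ M a b ν) ++ (N a b ν ++ mono (p + p') (q + q') (A ∘ₒ B) a b ν) ∎
  where
  open ≈-Reasoning
  M = mono p q A
  N = mono p' q' B
  L = oneS +S M

expand-side : ∀ I p q A p' q' B a b ν → (I *S ((oneS +S mono p q A) *S (oneS +S mono p' q' B))) a b ν ≈
  ((I *S 𝟙) a b ν ++ (I *S mono p q A) a b ν) ++ ((I *S mono p' q' B) a b ν ++ (I *S mono (p + p') (q + q') (A ∘ₒ B)) a b ν)
expand-side I p q A p' q' B a b ν =
  ≈-trans (*S-congʳ I (binomial-product p q A p' q' B) a b ν)
  (≈-trans (*S-distribˡ-+S I (𝟙 +S mono p q A) (mono p' q' B +S mono (p + p') (q + q') (A ∘ₒ B)) a b ν)
  (++-cong (*S-distribˡ-+S I 𝟙 (mono p q A) a b ν) (*S-distribˡ-+S I (mono p' q' B) (mono (p + p') (q + q') (A ∘ₒ B)) a b ν)))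

*S-mono-congˡ : ∀ S S' p q P ν → (∀ m n → apply (S m n) (P ν) ≈ apply (S' m n) (P ν)) →
  ∀ a b → (S *S mono p q P) a b ν ≈ (S' *S mono p q P) a b ν
*S-mono-congˡ S S' p q P ν agree a b with p ≤? a | q ≤? b
... | yes p≤a | yes q≤b =
  subst₂ (λ a b → (S *S mono p q P) a b ν ≈ (S' *S mono p q P) a b ν) (ℕP.m+[n∸m]≡n p≤a) (ℕP.m+[n∸m]≡n q≤b)
    (≈-trans (*S-mono-at S p q P (a ∸ p) (b ∸ q) ν)
    (≈-trans (agree (a ∸ p) (b ∸ q)) (≈-sym (*S-mono-at S' p q P (a ∸ p) (b ∸ q) ν))))
... | yes _ | no q≰b = ≈-trans (*S-mono-below S p q P a b ν (λ { (_ , q≤b) → q≰b q≤b }))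
                        (≈-sym (*S-mono-below S' p q P a b ν (λ { (_ , q≤b) → q≰b q≤b })))
... | no p≰a | _ = ≈-trans (*S-mono-below S p q P a b ν (λ { (p≤a , _) → p≰a p≤a }))
                    (≈-sym (*S-mono-below S' p q P a b ν (λ { (p≤a , _) → p≰a p≤a })))

module ExchangeIdentity (X Y U D : Op) (ν : List ℕ)
  (U-agree : ∀ n → apply (X ^ₒ n) (U ν) ≈ apply (Y ^ₒ n) (U ν))
  (D-agree : ∀ n → apply (X ^ₒ n) (D ν) ≈ apply (Y ^ₒ n) (D ν))
  (diagonal-agree : ∀ n → (X ^ₒ suc n) ν ++ apply (X ^ₒ n) ((U ∘ₒ D) ν) ≈ (Y ^ₒ suc n) ν ++ apply (Y ^ₒ n) ((D ∘ₒ U) ν))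
  where

  IX IY : Ser
  IX = inv1m (mono 1 1 X)
  IY = inv1m (mono 1 1 Y)

  off-diagonal-agree : ∀ P → (∀ n → apply (X ^ₒ n) (P ν) ≈ apply (Y ^ₒ n) (P ν)) →
    ∀ p q a b → (IX *S mono p q P) a b ν ≈ (IY *S mono p q P) a b ν
  off-diagonal-agree P agree p q = *S-mono-congˡ IX IY p q P ν
    (λ m n → inv1m-xy-apply-cong X Y m n (P ν) (λ _ → agree m))

  boundary : ∀ a b → (a ≡ b → apply (X ^ₒ a) (basis ν) ≈ apply (Y ^ₒ a) (basis ν)) → ¬ (1 ≤ a × 1 ≤ b) →
    (IX *S 𝟙) a b ν ++ (IX *S mono 1 1 (U ∘ₒ D)) a b ν ≈ (IY *S 𝟙) a b ν ++ (IY *S mono 1 1 (D ∘ₒ U)) a b ν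
  boundary a b agree outside = ++-cong
    (≈-trans (*S-mono-at IX 0 0 idₒ a b ν)
    (≈-trans (inv1m-xy-apply-cong X Y a b (basis ν) agree) (≈-sym (*S-mono-at IY 0 0 idₒ a b ν))))
    (≈-trans (*S-mono-below IX 1 1 (U ∘ₒ D) a b ν outside) (≈-sym (*S-mono-below IY 1 1 (D ∘ₒ U) a b ν outside)))

  diagonal-terms-agree : ∀ a b → (IX *S 𝟙) a b ν ++ (IX *S mono 1 1 (U ∘ₒ D)) a b ν ≈
                                  (IY *S 𝟙) a b ν ++ (IY *S mono 1 1 (D ∘ₒ U)) a b ν
  diagonal-terms-agree (suc m) (suc n) = begin
      (IX *S 𝟙) (suc m) (suc n) ν ++ (IX *S mono 1 1 (U ∘ₒ D)) (suc m) (suc n) ν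
        ≈⟨ ++-cong (*S-mono-at IX 0 0 idₒ (suc m) (suc n) ν) (*S-mono-at IX 1 1 (U ∘ₒ D) m n ν) ⟩
      apply (IX (suc m) (suc n)) (basis ν) ++ apply (IX m n) ((U ∘ₒ D) ν)
        ≈⟨ on-diagonal (m ℕ.≟ n) ⟩
      apply (IY (suc m) (suc n)) (basis ν) ++ apply (IY m n) ((D ∘ₒ U) ν)
        ≈⟨ ≈-sym (++-cong (*S-mono-at IY 0 0 idₒ (suc m) (suc n) ν) (*S-mono-at IY 1 1 (D ∘ₒ U) m n ν)) ⟩
      (IY *S 𝟙) (suc m) (suc n) ν ++ (IY *S mono 1 1 (D ∘ₒ U)) (suc m) (suc n) ν ∎
    where
    open ≈-Reasoning
    power : ∀ Z n v → apply (inv1m (mono 1 1 Z) n n) v ≈ apply (Z ^ₒ n) v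
    power Z n = apply-congˡ (inv1m-xy-diagonal Z n)
    vanish : ∀ Z m n v → m ≢ n → apply (inv1m (mono 1 1 Z) m n) v ≈ []
    vanish Z m n v m≢n = ≈-trans (apply-congˡ (inv1m-xy-offDiagonal Z m n m≢n) v) (≡⇒≈ (apply-zero v))
    on-diagonal : Dec (m ≡ n) → apply (IX (suc m) (suc n)) (basis ν) ++ apply (IX m n) ((U ∘ₒ D) ν) ≈
                                apply (IY (suc m) (suc n)) (basis ν) ++ apply (IY m n) ((D ∘ₒ U) ν)
    on-diagonal (yes refl) =
      ≈-trans (++-cong (≈-trans (power X (suc m) (basis ν)) (≡⇒≈ (apply-basis (X ^ₒ suc m) ν))) (power X m ((U ∘ₒ D) ν)))
      (≈-trans (diagonal-agree m)
      (≈-sym (++-cong (≈-trans (power Y (suc m) (basis ν)) (≡⇒≈ (apply-basis (Y ^ₒ suc m) ν))) (power Y m ((D ∘ₒ U) ν)))))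
    on-diagonal (no m≢n) =
      ≈-trans (++-cong (vanish X (suc m) (suc n) (basis ν) (λ eq → m≢n (ℕP.suc-injective eq))) (vanish X m n ((U ∘ₒ D) ν) m≢n))
      (≈-sym (++-cong (vanish Y (suc m) (suc n) (basis ν) (λ eq → m≢n (ℕP.suc-injective eq))) (vanish Y m n ((D ∘ₒ U) ν) m≢n)))
  diagonal-terms-agree zero b = boundary 0 b (λ _ → ≈-refl) (λ { (() , _) })
  diagonal-terms-agree (suc m) zero = boundary (suc m) 0 (λ ()) (λ { (_ , ()) })

  exchange : ∀ a b → (IX *S ((oneS +S mono 1 0 U) *S (oneS +S mono 0 1 D))) a b ν ≈
                     (IY *S ((oneS +S mono 0 1 D) *S (oneS +S mono 1 0 U))) a b ν
  exchange a b = begin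
      (IX *S ((oneS +S mono 1 0 U) *S (oneS +S mono 0 1 D))) a b ν
        ≈⟨ expand-side IX 1 0 U 0 1 D a b ν ⟩
      ((IX *S 𝟙) a b ν ++ (IX *S mono 1 0 U) a b ν) ++ ((IX *S mono 0 1 D) a b ν ++ (IX *S mono 1 1 (U ∘ₒ D)) a b ν)
        ≈⟨ ++-cong-crossed ((IX *S 𝟙) a b ν) ((IX *S mono 1 1 (U ∘ₒ D)) a b ν) ((IY *S 𝟙) a b ν) ((IY *S mono 1 1 (D ∘ₒ U)) a b ν)
             (diagonal-terms-agree a b) (off-diagonal-agree U U-agree 1 0 a b) (off-diagonal-agree D D-agree 0 1 a b) ⟩
      ((IY *S 𝟙) a b ν ++ (IY *S mono 0 1 D) a b ν) ++ ((IY *S mono 1 0 U) a b ν ++ (IY *S mono 1 1 (D ∘ₒ U)) a b ν)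
        ≈⟨ ≈-sym (expand-side IY 0 1 D 1 0 U a b ν) ⟩
      (IY *S ((oneS +S mono 0 1 D) *S (oneS +S mono 1 0 U))) a b ν ∎
    where open ≈-Reasoning

-- Partitions near two adjacent columns

addCol-++ : ∀ j P R → All (j ≤_) P → addCol j (P ++ R) ≡ Maybe.map (P ++_) (addCol j R)
addCol-++ j [] R [] = sym (Maybe.map-id (addCol j R))
addCol-++ j (r ∷ P) R (j≤r ∷ j≤P) with j ≤? r
... | yes _ = trans (cong (Maybe.map (r ∷_)) (addCol-++ j P R j≤P)) (sym (Maybe.map-∘ (addCol j R)))
... | no j≰r = ⊥-elim (j≰r j≤r)

addCol-extend : ∀ r T → addCol (suc r) (r ∷ T) ≡ just (suc r ∷ T)
addCol-extend r T with suc r ≤? r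
... | yes 1+r≤r = ⊥-elim (ℕP.<-irrefl refl 1+r≤r)
... | no _ with suc r ℕ.≟ suc r
...   | yes _ = refl
...   | no r≢r = ⊥-elim (r≢r refl)

addCol-blocked : ∀ j T → 2 ≤ j → All (λ r → suc r < j) T → addCol j T ≡ nothing
addCol-blocked j [] 2≤j [] with j ℕ.≟ 1
... | yes refl = ⊥-elim (ℕP.<-irrefl refl 2≤j)
... | no _ = refl
addCol-blocked j (r ∷ T) 2≤j (1+r<j ∷ _) with j ≤? r
... | yes j≤r = ⊥-elim (ℕP.<-irrefl refl (ℕP.<-trans (ℕP.n<1+n r) (ℕP.<-≤-trans 1+r<j j≤r)))
... | no _ with suc r ℕ.≟ j
...   | yes 1+r≡j = ⊥-elim (ℕP.<⇒≢ 1+r<j 1+r≡j)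
...   | no _ = refl

remCol-∷ : ∀ j r s rs → j ≤ s → remCol j (r ∷ s ∷ rs) ≡ Maybe.map (r ∷_) (remCol j (s ∷ rs))
remCol-∷ j r s rs j≤s with j ≤? s
... | yes _ = refl
... | no j≰s = ⊥-elim (j≰s j≤s)

remCol-++ : ∀ j P R → All (j <_) P → (j ≤ headOr0 R ⊎ remCol j R ≡ nothing) →
  remCol j (P ++ R) ≡ Maybe.map (P ++_) (remCol j R)
remCol-++ j [] R [] _ = sym (Maybe.map-id (remCol j R))
remCol-++ j (r ∷ []) R (j<r ∷ []) side with j ≤? headOr0 R | side
... | yes _ | _ = refl
... | no j≰ | inj₁ j≤ = ⊥-elim (j≰ j≤)
... | no _ | inj₂ none with r ℕ.≟ j
...   | yes r≡j = ⊥-elim (ℕP.<⇒≢ j<r (sym r≡j))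
...   | no _ = sym (cong (Maybe.map (r ∷_)) none)
remCol-++ j (r ∷ r' ∷ P) R (_ ∷ j<r'P@(j<r' ∷ _)) side =
  trans (remCol-∷ j r r' (P ++ R) (ℕP.<⇒≤ j<r'))
  (trans (cong (Maybe.map (r ∷_)) (remCol-++ j (r' ∷ P) R j<r'P side)) (sym (Maybe.map-∘ (remCol j R))))

headOr0-< : ∀ j T → 1 ≤ j → All (_< j) T → headOr0 T < j
headOr0-< j [] 1≤j _ = 1≤j
headOr0-< j (t ∷ T) _ (t<j ∷ _) = t<j

remCol-empty : ∀ j T → 1 ≤ j → All (_< j) T → remCol j T ≡ nothing
remCol-empty j [] _ _ = refl
remCol-empty j (r ∷ T) 1≤j (r<j ∷ T<j) with j ≤? headOr0 T
... | yes j≤ = ⊥-elim (ℕP.<⇒≱ (headOr0-< j T 1≤j T<j) j≤)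
... | no _ with r ℕ.≟ j
...   | yes r≡j = ⊥-elim (ℕP.<⇒≢ r<j r≡j)
...   | no _ = refl

remCol-replicate : ∀ j n T → 1 ≤ j → All (_< j) T →
  remCol j (replicate (suc n) j ++ T) ≡ just (replicate n j ++ shrinkRow (j ∸ 1) T)
remCol-replicate j (suc n) T 1≤j T<j with j ≤? j
... | yes _ = cong (Maybe.map (j ∷_)) (remCol-replicate j n T 1≤j T<j)
... | no j≰j = ⊥-elim (j≰j ℕP.≤-refl)
remCol-replicate j zero T 1≤j T<j with j ≤? headOr0 T
... | yes j≤ = ⊥-elim (ℕP.<⇒≱ (headOr0-< j T 1≤j T<j) j≤)
... | no _ with j ℕ.≟ j
...   | yes _ = refl
...   | no j≢j = ⊥-elim (j≢j refl)

remCol-side-replicate : ∀ j T → 1 ≤ j → All (_< j) T → ∀ n →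
  j ≤ headOr0 (replicate n j ++ T) ⊎ remCol j (replicate n j ++ T) ≡ nothing
remCol-side-replicate j T 1≤j T<j zero = inj₂ (remCol-empty j T 1≤j T<j)
remCol-side-replicate j T 1≤j T<j (suc n) = inj₁ ℕP.≤-refl

replicate-++-∷ : ∀ {A : Set} (a : A) n T → replicate n a ++ (a ∷ T) ≡ a ∷ (replicate n a ++ T)
replicate-++-∷ a zero T = refl
replicate-++-∷ a (suc n) T = cong (a ∷_) (replicate-++-∷ a n T)

sum-replicate : ∀ n r → sum (replicate n r) ≡ n ℕ.* r
sum-replicate zero r = refl
sum-replicate (suc n) r = cong (λ s → r + s) (sum-replicate n r)

rowsOf : ℕ → ℕ → List ℕ
rowsOf zero n = []
rowsOf (suc r) n = replicate n (suc r)

-- A partition as seen from columns i = suc i₀ and i + 1: rows longer than i + 1, then x, y, z rows of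
-- lengths i + 1, i, i − 1 (rowsOf 0 z = [], as partitions have no empty rows), then shorter rows.
shape : ℕ → List ℕ → List ℕ → ℕ → ℕ → ℕ → List ℕ
shape i₀ A B x y z = A ++ replicate x (suc (suc i₀)) ++ replicate y (suc i₀) ++ rowsOf i₀ z ++ B

record RowSplit (v : ℕ) (L : List ℕ) : Set where
  constructor rowSplit
  field
    above : List ℕ
    count : ℕ
    below : List ℕ
    above-> : All (v <_) above
    below-< : All (_< v) below
    below-partition : IsPartition below
    split-eq : L ≡ above ++ replicate count v ++ below

partition-≤-head : ∀ {r rs} → IsPartition (r ∷ rs) → All (_≤ r) (r ∷ rs)
partition-≤-head (one _) = ℕP.≤-refl ∷ []
partition-≤-head (cons s≤r p) = ℕP.≤-refl ∷ All.map (λ t≤s → ℕP.≤-trans t≤s s≤r) (partition-≤-head p)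

splitAtRow : ∀ v L → IsPartition L → RowSplit v L
splitAtRow v [] nil = rowSplit [] 0 [] [] [] nil refl
splitAtRow v (r ∷ []) (one 1≤r) with ℕP.<-cmp r v
... | tri< r<v _ _ = rowSplit [] 0 (r ∷ []) [] (r<v ∷ []) (one 1≤r) refl
... | tri≈ _ refl _ = rowSplit [] 1 [] [] [] nil refl
... | tri> _ _ v<r = rowSplit (r ∷ []) 0 [] (v<r ∷ []) [] nil refl
splitAtRow v (r ∷ s ∷ rs) p@(cons s≤r p') with ℕP.<-cmp r v | splitAtRow v (s ∷ rs) p'
... | tri< r<v _ _ | _ =
  rowSplit [] 0 (r ∷ s ∷ rs) [] (All.map (λ t≤r → ℕP.≤-<-trans t≤r r<v) (partition-≤-head p)) p refl
... | tri> _ _ v<r | rowSplit A n C A> C< C-part eq =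
  rowSplit (r ∷ A) n C (v<r ∷ A>) C< C-part (cong (r ∷_) eq)
... | tri≈ _ refl _ | rowSplit [] n C _ C< C-part eq =
  rowSplit [] (suc n) C [] C< C-part (cong (r ∷_) eq)
... | tri≈ _ refl _ | rowSplit (a ∷ A) n C (r<a ∷ _) _ _ eq =
  ⊥-elim (ℕP.<-irrefl refl (ℕP.<-≤-trans r<a (subst (_≤ r) (cong headOr0 eq) s≤r)))

above-empty : ∀ {v} A → All (v <_) A → All (_< suc v) A → A ≡ []
above-empty [] _ _ = refl
above-empty (a ∷ A) (v<a ∷ _) (a<1+v ∷ _) = ⊥-elim (ℕP.<-irrefl refl (ℕP.<-≤-trans v<a (ℕP.≤-pred a<1+v)))

partition-positive : ∀ C → IsPartition C → All (_< 1) C → C ≡ []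
partition-positive [] _ _ = refl
partition-positive (r ∷ []) (one 1≤r) (r<1 ∷ _) = ⊥-elim (ℕP.<-irrefl refl (ℕP.<-≤-trans r<1 1≤r))
partition-positive (r ∷ s ∷ rs) (cons _ p) (_ ∷ rest) with partition-positive (s ∷ rs) p rest
... | ()

splitBelow : ∀ v L → IsPartition L → All (_< suc v) L →
  Σ[ n ∈ ℕ ] Σ[ C ∈ List ℕ ] All (_< v) C × IsPartition C × L ≡ replicate n v ++ C
splitBelow v L p L≤v with splitAtRow v L p
... | rowSplit A n C A> C< C-part eq with above-empty A A> (All.++⁻ˡ A (subst (All (_< suc v)) eq L≤v))
...   | refl = n , C , C< , C-part , eq

lowestRows : ∀ i₀ C → IsPartition C → All (_< suc i₀) C → Σ[ z ∈ ℕ ] Σ[ B ∈ List ℕ ] All (_< i₀) B × C ≡ rowsOf i₀ z ++ B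
lowestRows zero C C-part C<1 = 0 , [] , [] , partition-positive C C-part C<1
lowestRows (suc i₁) C C-part C< with splitBelow (suc i₁) C C-part C<
... | z , B , B< , _ , eq = z , B , B< , eq

record Decomposition (i₀ : ℕ) (λ' : List ℕ) : Set where
  constructor decomposition
  field
    A B : List ℕ
    x y z : ℕ
    A-long : All (λ r → suc (suc i₀) < r) A
    B-short : All (_< i₀) B
    λ≡shape : λ' ≡ shape i₀ A B x y z

decompose : ∀ i₀ λ' → IsPartition λ' → Decomposition i₀ λ'
decompose i₀ λ' p with splitAtRow (suc (suc i₀)) λ' p
... | rowSplit A x C₁ A-long C₁< C₁-part refl with splitBelow (suc i₀) C₁ C₁-part C₁<
...   | y , C₂ , C₂< , C₂-part , refl with lowestRows i₀ C₂ C₂-part C₂<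
...     | z , B , B-short , refl = decomposition A B x y z A-long B-short refl

-- The operators ũ and d̃

β·_ : Elem → Elem
β·_ = scale 1ℤ 1

-β·_ : Elem → Elem
-β·_ = scale (-1ℤ) 1

-β·+β· : ∀ v → -β· v ++ β· v ≈ []
-β·+β· v = ≈-trans (scale-+ (-1ℤ) 1ℤ 1 v) (scale-zero 1 v)

-β·-cancel : ∀ a b → (a ++ -β· b) ++ β· b ≈ a
-β·-cancel a b = ≈-trans (≡⇒≈ (List.++-assoc a (-β· b) (β· b)))
  (≈-trans (++-cong (≈-refl {a}) (-β·+β· b)) (++-identityʳ a))

β·-cancel : ∀ a b → (a ++ β· b) ++ -β· b ≈ a
β·-cancel a b = ≈-trans (≡⇒≈ (List.++-assoc a (β· b) (-β· b)))
  (≈-trans (++-cong (≈-refl {a}) (≈-trans (++-comm (β· b) (-β· b)) (-β·+β· b))) (++-identityʳ a))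

β·-β· : ∀ v → β· (-β· v) ≡ -β· (β· v)
β·-β· v = trans (scale-scale 1ℤ 1 (-1ℤ) 1 v) (sym (scale-scale (-1ℤ) 1 1ℤ 1 v))

uT-expand : ∀ j μ → uT j μ ≡ u j μ ++ -β· apply (u j) (d j μ)
uT-expand j μ = trans (apply-++ (u j) (basis μ) (-β· d j μ))
  (cong₂ _++_ (apply-basis (u j) μ) (apply-scale (u j) (-1ℤ) 1 (d j μ)))

dPow-sucʳ : ∀ j k μ → dPow j (suc k) μ ≈ apply (dPow j k) (d j μ)
dPow-sucʳ j zero μ = ≡⇒≈ (trans (apply-basis (d j) μ) (sym (apply-id (d j μ))))
dPow-sucʳ j (suc k) μ = ≈-trans (apply-cong (d j) (dPow-sucʳ j k μ)) (≡⇒≈ (sym (apply-∘ (d j) (dPow j k) (d j μ))))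

dT-vanish : ∀ j μ → d j μ ≡ [] → dT j μ ≈ []
dT-vanish j μ dμ≡[] = concatMap-upTo-zero (λ k → scale 1ℤ k (dPow j (suc k) μ)) (size μ)
  (λ k _ → scale-cong 1ℤ k (≈-trans (dPow-sucʳ j k μ) (≡⇒≈ (cong (apply (dPow j k)) dμ≡[]))))

dT-step : ∀ j μ μ' → d j μ ≡ basis μ' → size μ ≡ suc (size μ') → dT j μ ≈ basis μ' ++ β· dT j μ'
dT-step j μ μ' dμ≡μ' size≡ rewrite size≡ = ++-cong first rest
  where
  term : ℕ → Elem
  term k = scale 1ℤ k (dPow j (suc k) μ)
  first : term 0 ≈ basis μ'
  first = ≈-trans (≡⇒≈ (scale-one _)) (≈-trans (dPow-sucʳ j 0 μ) (≡⇒≈ (trans (apply-id (d j μ)) dμ≡μ')))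
  shifted : ∀ k → term (suc k) ≈ β· scale 1ℤ k (dPow j (suc k) μ')
  shifted k = ≈-trans
    (scale-cong 1ℤ (suc k) (≈-trans (dPow-sucʳ j (suc k) μ)
      (≡⇒≈ (trans (cong (apply (dPow j (suc k))) dμ≡μ') (apply-basis (dPow j (suc k)) μ')))))
    (≡⇒≈ (sym (scale-scale 1ℤ 1 1ℤ k (dPow j (suc k) μ'))))
  rest : concatMap term (applyUpTo suc (size μ')) ≈ β· dT j μ'
  rest = ≈-trans (≡⇒≈ (trans (cong (concatMap term) (sym (List.map-upTo suc (size μ'))))
                             (List.concatMap-map term suc (upTo (size μ')))))
         (≈-trans (concatMap-cong shifted (upTo (size μ')))
         (≡⇒≈ (sym (scale-concatMap 1ℤ 1 (λ k → scale 1ℤ k (dPow j (suc k) μ')) (upTo (size μ'))))))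

-- Whether column i = suc i₀ can grow, given z rows of length i₀: for i = 1 a new row can always be started.
hasRoom : ℕ → ℕ → Bool
hasRoom _ (suc _) = true
hasRoom zero zero = true
hasRoom (suc _) zero = false

shrinkRow-rowsOf : ∀ r z B → shrinkRow r (rowsOf r z ++ B) ≡ rowsOf r (suc z) ++ B
shrinkRow-rowsOf zero z B = refl
shrinkRow-rowsOf (suc r) z B = refl

addCol-rowsOf : ∀ r z B → All (_< r) B →
  addCol (suc r) (rowsOf r z ++ B) ≡ (if hasRoom r z then just (suc r ∷ rowsOf r (pred z) ++ B) else nothing)
addCol-rowsOf zero zero [] [] = refl
addCol-rowsOf zero (suc z) [] [] = refl
addCol-rowsOf (suc r) zero B B< = addCol-blocked (suc (suc r)) B (s≤s (s≤s z≤n)) (All.map s≤s B<)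
addCol-rowsOf (suc r) (suc z) B B< = addCol-extend (suc r) (replicate z (suc r) ++ B)

rowsOf-< : ∀ r z → All (_< suc r) (rowsOf r z)
rowsOf-< zero z = []
rowsOf-< (suc r) z = All.replicate⁺ z ℕP.≤-refl

sum-rowsOf : ∀ r z → sum (rowsOf r z) ≡ z ℕ.* r
sum-rowsOf zero z = sym (ℕP.*-zeroʳ z)
sum-rowsOf (suc r) z = sum-replicate z (suc r)

module Neighbourhood (i₀ : ℕ) (A B : List ℕ)
  (A-long : All (λ r → suc (suc i₀) < r) A) (B-short : All (_< i₀) B) where

  i : ℕ
  i = suc i₀

  lowerRows : ℕ → List ℕ
  lowerRows z = rowsOf i₀ z ++ B

  middleRows : ℕ → ℕ → List ℕ
  middleRows y z = replicate y i ++ lowerRows z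

  E : ℕ → ℕ → ℕ → List ℕ
  E = shape i₀ A B

  lowerRows-< : ∀ z → All (_< i) (lowerRows z)
  lowerRows-< z = All.++⁺ (rowsOf-< i₀ z) (All.map ℕP.m<n⇒m<1+n B-short)

  middleRows-< : ∀ y z → All (_< suc i) (middleRows y z)
  middleRows-< y z = All.++⁺ (All.replicate⁺ y ℕP.≤-refl) (All.map ℕP.m<n⇒m<1+n (lowerRows-< z))

  remCol-i : ∀ x y z → remCol i (E x y z) ≡ Maybe.map (λ t → A ++ replicate x (suc i) ++ t) (remCol i (middleRows y z))
  remCol-i x y z =
    trans (remCol-++ i A _ (All.map (ℕP.<-trans (ℕP.n<1+n i)) A-long) (side x))
    (trans (cong (Maybe.map (A ++_)) (remCol-++ i (replicate x (suc i)) (middleRows y z) (All.replicate⁺ x ℕP.≤-refl)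
                                        (remCol-side-replicate i (lowerRows z) (s≤s z≤n) (lowerRows-< z) y)))
           (sym (Maybe.map-∘ (remCol i (middleRows y z)))))
    where
    side : ∀ x → i ≤ headOr0 (replicate x (suc i) ++ middleRows y z) ⊎ remCol i (replicate x (suc i) ++ middleRows y z) ≡ nothing
    side (suc _) = inj₁ (ℕP.n≤1+n i)
    side zero = remCol-side-replicate i (lowerRows z) (s≤s z≤n) (lowerRows-< z) y

  remCol-i+1 : ∀ x y z → remCol (suc i) (E x y z) ≡ Maybe.map (A ++_) (remCol (suc i) (replicate x (suc i) ++ middleRows y z))
  remCol-i+1 x y z = remCol-++ (suc i) A _ A-long (remCol-side-replicate (suc i) (middleRows y z) (s≤s z≤n) (middleRows-< y z) x)

  d-i-suc : ∀ x y z → d i (E x (suc y) z) ≡ basis (E x y (suc z))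
  d-i-suc x y z = cong fromMaybe (trans (remCol-i x (suc y) z)
    (cong (Maybe.map _) (trans (remCol-replicate i y (lowerRows z) (s≤s z≤n) (lowerRows-< z))
                               (cong (λ t → just (replicate y i ++ t)) (shrinkRow-rowsOf i₀ z B)))))

  d-i-zero : ∀ x z → d i (E x 0 z) ≡ []
  d-i-zero x z = cong fromMaybe (trans (remCol-i x 0 z) (cong (Maybe.map _) (remCol-empty i (lowerRows z) (s≤s z≤n) (lowerRows-< z))))

  d-i+1-suc : ∀ x y z → d (suc i) (E (suc x) y z) ≡ basis (E x (suc y) z)
  d-i+1-suc x y z = cong fromMaybe (trans (remCol-i+1 (suc x) y z)
    (cong (Maybe.map (A ++_)) (remCol-replicate (suc i) x (middleRows y z) (s≤s z≤n) (middleRows-< y z))))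

  d-i+1-zero : ∀ y z → d (suc i) (E 0 y z) ≡ []
  d-i+1-zero y z = cong fromMaybe (trans (remCol-i+1 0 y z)
    (cong (Maybe.map (A ++_)) (remCol-empty (suc i) (middleRows y z) (s≤s z≤n) (middleRows-< y z))))

  addCol-i+1 : ∀ x y z → addCol (suc i) (E x y z) ≡ Maybe.map (λ t → A ++ replicate x (suc i) ++ t) (addCol (suc i) (middleRows y z))
  addCol-i+1 x y z =
    trans (addCol-++ (suc i) A _ (All.map ℕP.<⇒≤ A-long))
    (trans (cong (Maybe.map (A ++_)) (addCol-++ (suc i) (replicate x (suc i)) (middleRows y z) (All.replicate⁺ x ℕP.≤-refl)))
           (sym (Maybe.map-∘ (addCol (suc i) (middleRows y z)))))

  u-i+1-suc : ∀ x y z → u (suc i) (E x (suc y) z) ≡ basis (E (suc x) y z)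
  u-i+1-suc x y z = cong fromMaybe (trans (addCol-i+1 x (suc y) z)
    (trans (cong (Maybe.map _) (addCol-extend i (middleRows y z)))
           (cong (λ t → just (A ++ t)) (replicate-++-∷ (suc i) x (middleRows y z)))))

  u-i+1-zero : ∀ x z → u (suc i) (E x 0 z) ≡ []
  u-i+1-zero x z = cong fromMaybe (trans (addCol-i+1 x 0 z)
    (cong (Maybe.map _) (addCol-blocked (suc i) (lowerRows z) (s≤s (s≤s z≤n)) (All.map s≤s (lowerRows-< z)))))

  addCol-i : ∀ x y z → addCol i (E x y z) ≡ (if hasRoom i₀ z then just (E x (suc y) (pred z)) else nothing)
  addCol-i x y z = begin
      addCol i (A ++ replicate x (suc i) ++ replicate y i ++ lowerRows z)
        ≡⟨ addCol-++ i A _ (All.map (λ i+1<r → ℕP.<⇒≤ (ℕP.<-trans (ℕP.n<1+n i) i+1<r)) A-long) ⟩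
      Maybe.map (A ++_) (addCol i (replicate x (suc i) ++ replicate y i ++ lowerRows z))
        ≡⟨ cong (Maybe.map (A ++_)) (addCol-++ i (replicate x (suc i)) _ (All.replicate⁺ x (ℕP.n≤1+n i))) ⟩
      Maybe.map (A ++_) (Maybe.map (replicate x (suc i) ++_) (addCol i (replicate y i ++ lowerRows z)))
        ≡⟨ cong (λ m → Maybe.map (A ++_) (Maybe.map (replicate x (suc i) ++_) m))
                (trans (addCol-++ i (replicate y i) (lowerRows z) (All.replicate⁺ y ℕP.≤-refl))
                       (cong (Maybe.map (replicate y i ++_)) (addCol-rowsOf i₀ z B B-short))) ⟩
      Maybe.map (A ++_) (Maybe.map (replicate x (suc i) ++_) (Maybe.map (replicate y i ++_)
        (if hasRoom i₀ z then just (i ∷ lowerRows (pred z)) else nothing)))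
        ≡⟨ if-float (λ m → Maybe.map (A ++_) (Maybe.map (replicate x (suc i) ++_) (Maybe.map (replicate y i ++_) m))) (hasRoom i₀ z) ⟩
      (if hasRoom i₀ z then just (A ++ replicate x (suc i) ++ replicate y i ++ i ∷ lowerRows (pred z)) else nothing)
        ≡⟨ cong (λ t → if hasRoom i₀ z then just (A ++ replicate x (suc i) ++ t) else nothing)
                (replicate-++-∷ i y (lowerRows (pred z))) ⟩
      (if hasRoom i₀ z then just (E x (suc y) (pred z)) else nothing) ∎
    where open ≡-Reasoning

  size-E : ∀ x y z → size (E x y z) ≡ sum A + (x ℕ.* suc i + (y ℕ.* i + (z ℕ.* i₀ + sum B)))
  size-E x y z =
    trans (Sum.sum-++ A _) (cong (sum A +_)
    (trans (Sum.sum-++ (replicate x (suc i)) _) (cong₂ _+_ (sum-replicate x (suc i))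
    (trans (Sum.sum-++ (replicate y i) _) (cong₂ _+_ (sum-replicate y i)
    (trans (Sum.sum-++ (rowsOf i₀ z) B) (cong (_+ sum B) (sum-rowsOf i₀ z))))))))

  size-d-i+1 : ∀ x y z → size (E (suc x) y z) ≡ suc (size (E x (suc y) z))
  size-d-i+1 x y z = trans (size-E (suc x) y z) (trans (moved (sum A) x y z i₀ (sum B)) (cong suc (sym (size-E x (suc y) z))))
    where
    moved : ∀ a x y z i₀ s → a + (suc x ℕ.* suc (suc i₀) + (y ℕ.* suc i₀ + (z ℕ.* i₀ + s))) ≡
                             suc (a + (x ℕ.* suc (suc i₀) + (suc y ℕ.* suc i₀ + (z ℕ.* i₀ + s))))
    moved = ℕ-Solver.solve-∀

  size-d-i : ∀ x y z → size (E x (suc y) z) ≡ suc (size (E x y (suc z)))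
  size-d-i x y z = trans (size-E x (suc y) z) (trans (moved (sum A) x y z i₀ (sum B)) (cong suc (sym (size-E x y (suc z)))))
    where
    moved : ∀ a x y z i₀ s → a + (x ℕ.* suc (suc i₀) + (suc y ℕ.* suc i₀ + (z ℕ.* i₀ + s))) ≡
                             suc (a + (x ℕ.* suc (suc i₀) + (y ℕ.* suc i₀ + (suc z ℕ.* i₀ + s))))
    moved = ℕ-Solver.solve-∀

  room : ℕ → Elem → Elem
  room z v = if hasRoom i₀ z then v else []

  room-[] : ∀ z → room z [] ≡ []
  room-[] z with hasRoom i₀ z
  ... | true = refl
  ... | false = refl

  room-++ : ∀ z v w → room z (v ++ w) ≡ room z v ++ room z w
  room-++ z v w with hasRoom i₀ z
  ... | true = refl
  ... | false = refl

  room-β· : ∀ z v → room z (β· v) ≡ β· room z v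
  room-β· z v with hasRoom i₀ z
  ... | true = refl
  ... | false = refl

  room-cong : ∀ z {v w} → v ≈ w → room z v ≈ room z w
  room-cong z v≈w with hasRoom i₀ z
  ... | true = v≈w
  ... | false = ≈-refl

  apply-room : ∀ O z v → apply O (room z v) ≡ room z (apply O v)
  apply-room O z v = if-float (apply O) (hasRoom i₀ z)

  e : ℕ → ℕ → ℕ → Elem
  e x y z = basis (E x y z)

  u-i : ∀ x y z → u i (E x y z) ≡ room z (e x (suc y) (pred z))
  u-i x y z = trans (cong fromMaybe (addCol-i x y z)) (if-float fromMaybe (hasRoom i₀ z))

  U D X Y : Op
  U = uT i
  D = dT (suc i)
  X = U ∘ₒ dT i
  Y = D ∘ₒ uT (suc i)

  d̃ᵢ₊₁E : ℕ → ℕ → ℕ → Elem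
  d̃ᵢ₊₁E zero y z = []
  d̃ᵢ₊₁E (suc x) y z = e x (suc y) z ++ β· d̃ᵢ₊₁E x (suc y) z

  d̃ᵢE : ℕ → ℕ → ℕ → Elem
  d̃ᵢE x zero z = []
  d̃ᵢE x (suc y) z = e x y (suc z) ++ β· d̃ᵢE x y (suc z)

  ũᵢE : ℕ → ℕ → ℕ → Elem
  ũᵢE x zero z = room z (e x 1 (pred z))
  ũᵢE x (suc y) z = room z (e x (suc (suc y)) (pred z)) ++ -β· e x (suc y) z

  d̃ᵢ₊₁ũᵢE : ℕ → ℕ → ℕ → Elem
  d̃ᵢ₊₁ũᵢE x zero z = room z (d̃ᵢ₊₁E x 1 (pred z))
  d̃ᵢ₊₁ũᵢE x (suc y) z = room z (d̃ᵢ₊₁E x (suc (suc y)) (pred z)) ++ -β· d̃ᵢ₊₁E x (suc y) z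

  D-E : ∀ x y z → D (E x y z) ≈ d̃ᵢ₊₁E x y z
  D-E zero y z = dT-vanish (suc i) (E 0 y z) (d-i+1-zero y z)
  D-E (suc x) y z = ≈-trans (dT-step (suc i) (E (suc x) y z) (E x (suc y) z) (d-i+1-suc x y z) (size-d-i+1 x y z))
    (++-cong (≈-refl {e x (suc y) z}) (scale-cong 1ℤ 1 (D-E x (suc y) z)))

  dTᵢ-E : ∀ x y z → dT i (E x y z) ≈ d̃ᵢE x y z
  dTᵢ-E x zero z = dT-vanish i (E x 0 z) (d-i-zero x z)
  dTᵢ-E x (suc y) z = ≈-trans (dT-step i (E x (suc y) z) (E x y (suc z)) (d-i-suc x y z) (size-d-i x y z))
    (++-cong (≈-refl {e x y (suc z)}) (scale-cong 1ℤ 1 (dTᵢ-E x y (suc z))))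

  U-E : ∀ x y z → U (E x y z) ≡ ũᵢE x y z
  U-E x zero z = trans (uT-expand i (E x 0 z))
    (trans (cong (λ v → u i (E x 0 z) ++ -β· apply (u i) v) (d-i-zero x z))
    (trans (List.++-identityʳ _) (u-i x 0 z)))
  U-E x (suc y) z = trans (uT-expand i (E x (suc y) z))
    (cong₂ (λ v w → v ++ -β· w) (u-i x (suc y) z)
           (trans (cong (apply (u i)) (d-i-suc x y z)) (trans (apply-basis (u i) (E x y (suc z))) (u-i x y (suc z)))))

  apply-U-e : ∀ x y z → apply U (e x y z) ≡ ũᵢE x y z
  apply-U-e x y z = trans (apply-basis U (E x y z)) (U-E x y z)

  apply-D-e : ∀ x y z → apply D (e x y z) ≈ d̃ᵢ₊₁E x y z
  apply-D-e x y z = ≈-trans (≡⇒≈ (apply-basis D (E x y z))) (D-E x y z)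

  apply-D-ũᵢE : ∀ x y z → apply D (ũᵢE x y z) ≈ d̃ᵢ₊₁ũᵢE x y z
  apply-D-ũᵢE x zero z = ≈-trans (≡⇒≈ (apply-room D z (e x 1 (pred z)))) (room-cong z (apply-D-e x 1 (pred z)))
  apply-D-ũᵢE x (suc y) z = ≈-trans (≡⇒≈ (apply-++ D (room z (e x (suc (suc y)) (pred z))) (-β· e x (suc y) z)))
    (++-cong (≈-trans (≡⇒≈ (apply-room D z _)) (room-cong z (apply-D-e x (suc (suc y)) (pred z))))
             (≈-trans (≡⇒≈ (apply-scale D -1ℤ 1 (e x (suc y) z))) (scale-cong -1ℤ 1 (apply-D-e x (suc y) z))))

  D-ud-i+1 : ∀ x y z → apply D (apply (u (suc i)) (d (suc i) (E x y z))) ≈ d̃ᵢ₊₁E x y z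
  D-ud-i+1 zero y z = ≡⇒≈ (cong (λ v → apply D (apply (u (suc i)) v)) (d-i+1-zero y z))
  D-ud-i+1 (suc x) y z = ≈-trans
    (≡⇒≈ (cong (apply D) (trans (cong (apply (u (suc i))) (d-i+1-suc x y z))
                         (trans (apply-basis (u (suc i)) (E x (suc y) z)) (u-i+1-suc x y z)))))
    (apply-D-e (suc x) y z)

  Y-expand : ∀ x y z → Y (E x y z) ≈ apply D (u (suc i) (E x y z)) ++ -β· d̃ᵢ₊₁E x y z
  Y-expand x y z = ≈-trans
    (≡⇒≈ (trans (cong (apply D) (uT-expand (suc i) (E x y z)))
         (trans (apply-++ D (u (suc i) (E x y z)) (-β· ud)) (cong (apply D (u (suc i) (E x y z)) ++_) (apply-scale D -1ℤ 1 ud)))))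
    (++-cong (≈-refl {apply D (u (suc i) (E x y z))}) (scale-cong -1ℤ 1 (D-ud-i+1 x y z)))
    where
    ud : Elem
    ud = apply (u (suc i)) (d (suc i) (E x y z))

  X-fixes : ∀ x y z → X (E x (suc y) z) ≈ e x (suc y) z
  X-fixes x y z = ≈-trans (apply-cong U (dTᵢ-E x (suc y) z)) (telescope y z)
    where
    telescope : ∀ y z → apply U (d̃ᵢE x (suc y) z) ≈ e x (suc y) z
    telescope y z = ≈-trans
      (≡⇒≈ (trans (apply-++ U (e x y (suc z)) (β· d̃ᵢE x y (suc z)))
                  (cong₂ _++_ (apply-U-e x y (suc z)) (apply-scale U 1ℤ 1 (d̃ᵢE x y (suc z))))))
      (collapse y)
      where
      collapse : ∀ y → ũᵢE x y (suc z) ++ β· apply U (d̃ᵢE x y (suc z)) ≈ e x (suc y) z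
      collapse zero = ++-identityʳ (e x 1 z)
      collapse (suc y) = ≈-trans (++-cong (≈-refl {ũᵢE x (suc y) (suc z)}) (scale-cong 1ℤ 1 (telescope y (suc z))))
                                 (-β·-cancel (e x (suc (suc y)) z) (e x (suc y) (suc z)))

  X-vanishes : ∀ x z → X (E x 0 z) ≈ []
  X-vanishes x z = apply-cong U (dTᵢ-E x 0 z)

  Y-fixes : ∀ x y z → Y (E x (suc y) z) ≈ e x (suc y) z
  Y-fixes x y z = ≈-trans (Y-expand x (suc y) z)
    (≈-trans (++-cong (≈-trans (≡⇒≈ (cong (apply D) (u-i+1-suc x y z))) (apply-D-e (suc x) y z)) (≈-refl { -β· d̃ᵢ₊₁E x (suc y) z}))
             (β·-cancel (e x (suc y) z) (d̃ᵢ₊₁E x (suc y) z)))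

  Y-on-zero : ∀ x z → Y (E x 0 z) ≈ -β· d̃ᵢ₊₁E x 0 z
  Y-on-zero x z = ≈-trans (Y-expand x 0 z) (≡⇒≈ (cong (λ v → apply D v ++ -β· d̃ᵢ₊₁E x 0 z) (u-i+1-zero x z)))

  -- ũᵢ only moves boxes between columns i − 1 and i, and d̃ᵢ₊₁ only between columns i and i + 1.
  ũᵢ-d̃ᵢ₊₁-step : ∀ x y z → ũᵢE x (suc y) z ++ β· d̃ᵢ₊₁ũᵢE x (suc y) z ≈
                            room z (d̃ᵢ₊₁E (suc x) (suc y) (pred z)) ++ -β· d̃ᵢ₊₁E (suc x) y z
  ũᵢ-d̃ᵢ₊₁-step x y z = begin
      (room z a ++ -β· b) ++ β· (room z a' ++ -β· b')
        ≡⟨ cong ((room z a ++ -β· b) ++_) (trans (scale-++ 1ℤ 1 (room z a') (-β· b'))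
                                                (cong₂ _++_ (sym (room-β· z a')) (β·-β· b'))) ⟩
      (room z a ++ -β· b) ++ (room z (β· a') ++ -β· β· b')
        ≈⟨ ++-interchange (room z a) (-β· b) (room z (β· a')) (-β· β· b') ⟩
      (room z a ++ room z (β· a')) ++ (-β· b ++ -β· β· b')
        ≡⟨ cong₂ _++_ (sym (room-++ z a (β· a'))) (sym (scale-++ -1ℤ 1 b (β· b'))) ⟩
      room z (d̃ᵢ₊₁E (suc x) (suc y) (pred z)) ++ -β· d̃ᵢ₊₁E (suc x) y z ∎
    where
    open ≈-Reasoning
    a = e x (suc (suc y)) (pred z)
    a' = d̃ᵢ₊₁E x (suc (suc y)) (pred z)
    b = e x (suc y) z
    b' = d̃ᵢ₊₁E x (suc y) z

  U-d̃ᵢ₊₁E-unfold : ∀ x y z → apply U (d̃ᵢ₊₁E (suc x) y z) ≡ ũᵢE x (suc y) z ++ β· apply U (d̃ᵢ₊₁E x (suc y) z)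
  U-d̃ᵢ₊₁E-unfold x y z = trans (apply-++ U (e x (suc y) z) (β· d̃ᵢ₊₁E x (suc y) z))
    (cong₂ _++_ (apply-U-e x (suc y) z) (apply-scale U 1ℤ 1 (d̃ᵢ₊₁E x (suc y) z)))

  U-d̃ᵢ₊₁E-suc : ∀ x y z → apply U (d̃ᵢ₊₁E x (suc y) z) ≈ d̃ᵢ₊₁ũᵢE x (suc y) z
  U-d̃ᵢ₊₁E-suc zero y z = ≡⇒≈ (sym (cong (_++ []) (room-[] z)))
  U-d̃ᵢ₊₁E-suc (suc x) y z = ≈-trans (≡⇒≈ (U-d̃ᵢ₊₁E-unfold x (suc y) z))
    (≈-trans (++-cong (≈-refl {ũᵢE x (suc (suc y)) z}) (scale-cong 1ℤ 1 (U-d̃ᵢ₊₁E-suc x (suc y) z)))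
             (ũᵢ-d̃ᵢ₊₁-step x (suc y) z))

  U-d̃ᵢ₊₁E-zero : ∀ x z → apply U (d̃ᵢ₊₁E x 0 z) ≈ -β· d̃ᵢ₊₁E x 0 z ++ d̃ᵢ₊₁ũᵢE x 0 z
  U-d̃ᵢ₊₁E-zero zero z = ≡⇒≈ (sym (room-[] z))
  U-d̃ᵢ₊₁E-zero (suc x) z = ≈-trans (≡⇒≈ (U-d̃ᵢ₊₁E-unfold x 0 z))
    (≈-trans (++-cong (≈-refl {ũᵢE x 1 z}) (scale-cong 1ℤ 1 (U-d̃ᵢ₊₁E-suc x 0 z)))
    (≈-trans (ũᵢ-d̃ᵢ₊₁-step x 0 z) (++-comm _ (-β· d̃ᵢ₊₁E (suc x) 0 z))))

  commutator : ∀ x y z → X (E x y z) ++ apply U (D (E x y z)) ≈ Y (E x y z) ++ apply D (U (E x y z))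
  commutator x (suc y) z = ++-cong (≈-trans (X-fixes x y z) (≈-sym (Y-fixes x y z)))
    (≈-trans (apply-cong U (D-E x (suc y) z))
    (≈-trans (U-d̃ᵢ₊₁E-suc x y z)
    (≈-sym (≈-trans (≡⇒≈ (cong (apply D) (U-E x (suc y) z))) (apply-D-ũᵢE x (suc y) z)))))
  commutator x zero z = ≈-trans (++-cong (X-vanishes x z) (≈-trans (apply-cong U (D-E x 0 z)) (U-d̃ᵢ₊₁E-zero x z)))
    (≈-sym (++-cong (Y-on-zero x z) (≈-trans (≡⇒≈ (cong (apply D) (U-E x 0 z))) (apply-D-ũᵢE x 0 z))))

  HasRowᵢ : List ℕ → Set
  HasRowᵢ ν = Σ[ x ∈ ℕ ] Σ[ y ∈ ℕ ] Σ[ z ∈ ℕ ] ν ≡ E x (suc y) z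

  Supported : Elem → Set
  Supported = All (λ t → HasRowᵢ (basisOf t))

  Supported-scale : ∀ c j v → Supported v → Supported (scale c j v)
  Supported-scale c j [] [] = []
  Supported-scale c j ((_ , _ , _) ∷ v) (h ∷ hs) = h ∷ Supported-scale c j v hs

  Supported-room : ∀ z v → Supported v → Supported (room z v)
  Supported-room z v sv with hasRoom i₀ z
  ... | true = sv
  ... | false = []

  Supported-e : ∀ x y z → Supported (e x (suc y) z)
  Supported-e x y z = (x , y , z , refl) ∷ []

  Supported-d̃ᵢ₊₁E : ∀ x y z → Supported (d̃ᵢ₊₁E x y z)
  Supported-d̃ᵢ₊₁E zero y z = []
  Supported-d̃ᵢ₊₁E (suc x) y z = All.++⁺ (Supported-e x y z) (Supported-scale 1ℤ 1 _ (Supported-d̃ᵢ₊₁E x (suc y) z))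

  Supported-ũᵢE : ∀ x y z → Supported (ũᵢE x y z)
  Supported-ũᵢE x zero z = Supported-room z _ (Supported-e x 0 (pred z))
  Supported-ũᵢE x (suc y) z = All.++⁺ (Supported-room z _ (Supported-e x (suc y) (pred z))) (Supported-scale -1ℤ 1 _ (Supported-e x y z))

  Supported-d̃ᵢ₊₁ũᵢE : ∀ x y z → Supported (d̃ᵢ₊₁ũᵢE x y z)
  Supported-d̃ᵢ₊₁ũᵢE x zero z = Supported-room z _ (Supported-d̃ᵢ₊₁E x 1 (pred z))
  Supported-d̃ᵢ₊₁ũᵢE x (suc y) z =
    All.++⁺ (Supported-room z _ (Supported-d̃ᵢ₊₁E x (suc (suc y)) (pred z))) (Supported-scale -1ℤ 1 _ (Supported-d̃ᵢ₊₁E x (suc y) z))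

  powers-fix : ∀ O → (∀ x y z → O (E x (suc y) z) ≈ e x (suc y) z) →
    ∀ n {v w} → v ≈ w → Supported w → apply (O ^ₒ n) v ≈ v
  powers-fix O fixes n {v} {w} v≈w sw = ≈-trans (apply-cong (O ^ₒ n) v≈w) (≈-trans (on-supported n) (≈-sym v≈w))
    where
    fixes-all : apply O w ≈ w
    fixes-all = ≈-trans (apply-cong-on {P = idₒ} w (All.map (λ { (x , y , z , refl) → fixes x y z }) sw)) (≡⇒≈ (apply-id w))
    on-supported : ∀ n → apply (O ^ₒ n) w ≈ w
    on-supported zero = ≡⇒≈ (apply-id w)
    on-supported (suc n) = ≈-trans (≡⇒≈ (apply-∘ O (O ^ₒ n) w)) (≈-trans (apply-cong O (on-supported n)) fixes-all)

  powers-agree : ∀ n {v w} → v ≈ w → Supported w → apply (X ^ₒ n) v ≈ apply (Y ^ₒ n) v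
  powers-agree n v≈w sw = ≈-trans (powers-fix X X-fixes n v≈w sw) (≈-sym (powers-fix Y Y-fixes n v≈w sw))

  U-agree : ∀ x y z n → apply (X ^ₒ n) (U (E x y z)) ≈ apply (Y ^ₒ n) (U (E x y z))
  U-agree x y z n = powers-agree n (≡⇒≈ (U-E x y z)) (Supported-ũᵢE x y z)

  D-agree : ∀ x y z n → apply (X ^ₒ n) (D (E x y z)) ≈ apply (Y ^ₒ n) (D (E x y z))
  D-agree x y z n = powers-agree n (D-E x y z) (Supported-d̃ᵢ₊₁E x y z)

  YE : ℕ → ℕ → ℕ → Elem
  YE x zero z = -β· d̃ᵢ₊₁E x 0 z
  YE x (suc y) z = e x (suc y) z

  Y-E : ∀ x y z → Y (E x y z) ≈ YE x y z
  Y-E x zero z = Y-on-zero x z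
  Y-E x (suc y) z = Y-fixes x y z

  Supported-YE : ∀ x y z → Supported (YE x y z)
  Supported-YE x zero z = Supported-scale -1ℤ 1 _ (Supported-d̃ᵢ₊₁E x 0 z)
  Supported-YE x (suc y) z = Supported-e x y z

  diagonal-agree : ∀ x y z n → let ν = E x y z in
    (X ^ₒ suc n) ν ++ apply (X ^ₒ n) ((U ∘ₒ D) ν) ≈ (Y ^ₒ suc n) ν ++ apply (Y ^ₒ n) ((D ∘ₒ U) ν)
  diagonal-agree x y z n = begin
      (X ^ₒ suc n) ν ++ apply (X ^ₒ n) (apply U (D ν))
        ≈⟨ ++-cong (^ₒ-sucʳ X n ν) (≈-refl {apply (X ^ₒ n) (apply U (D ν))}) ⟩
      apply (X ^ₒ n) (X ν) ++ apply (X ^ₒ n) (apply U (D ν))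
        ≡⟨ sym (apply-++ (X ^ₒ n) (X ν) (apply U (D ν))) ⟩
      apply (X ^ₒ n) (X ν ++ apply U (D ν))
        ≈⟨ apply-cong (X ^ₒ n) (commutator x y z) ⟩
      apply (X ^ₒ n) (Y ν ++ apply D (U ν))
        ≈⟨ powers-agree n (++-cong (Y-E x y z) (≈-trans (≡⇒≈ (cong (apply D) (U-E x y z))) (apply-D-ũᵢE x y z)))
                          (All.++⁺ (Supported-YE x y z) (Supported-d̃ᵢ₊₁ũᵢE x y z)) ⟩
      apply (Y ^ₒ n) (Y ν ++ apply D (U ν))
        ≡⟨ apply-++ (Y ^ₒ n) (Y ν) (apply D (U ν)) ⟩
      apply (Y ^ₒ n) (Y ν) ++ apply (Y ^ₒ n) (apply D (U ν))
        ≈⟨ ++-cong (≈-sym (^ₒ-sucʳ Y n ν)) (≈-refl {apply (Y ^ₒ n) (apply D (U ν))}) ⟩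
      (Y ^ₒ suc n) ν ++ apply (Y ^ₒ n) (apply D (U ν)) ∎
    where
    open ≈-Reasoning
    ν = E x y z

lemma5p3 : (i : ℕ) → 1 ≤ i → (λ' : List ℕ) → IsPartition λ' →
    (a b : ℕ) (μ : List ℕ) (k : ℕ) →
    coeff μ k (LHS i a b λ') ≡ coeff μ k (RHS i a b λ')
lemma5p3 (suc i₀) _ λ' p a b μ k with decompose i₀ λ' p
... | decomposition A B x y z A-long B-short refl =
  coeff-≡ (Exchange.exchange a b) μ k
  where
  open Neighbourhood i₀ A B A-long B-short
  module Exchange = ExchangeIdentity X Y U D (E x y z) (U-agree x y z) (D-agree x y z) (diagonal-agree x y z)
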